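{- Let $s,t$ be coprime positive integers, and let $\lambda,\mu$ be $s$-cores. Suppose there is a bijection $\phi:\mathcal{Q}(\lambda)\to\mathcal{Q}(\mu)$ such that $\phi(b)\equiv b\pmod t$ for every $b\in\mathcal{Q}(\lambda)$. Then $\lambda$ and $\mu$ have the same $t$-core.
   Context: A partition is a weakly decreasing sequence $\lambda=(\lambda_1,\lambda_2,\dots)$ of non-negative integers with finite sum; its Young diagram is $[\lambda]=\{(i,j)\in\mathbb{N}^2: j\leqslant\lambda_i\}$. A rim $s$-hook is a connected set of $s$ boxes of the rim (boxes $(i,j)\in[\lambda]$ with $(i+1,j+1)\notin[\lambda]$) whose removal leaves a Young diagram; $\lambda$ is an $s$-core if it has no rim $s$-hook, and the $s$-core of $\lambda$ is the (well-defined) partition obtained by repeatedly removing rim $s$-hooks. The beta-set of $\lambda$ is $\{\lambda_i-i: i\geqslant1\}$. A partition is an $s$-core iff whenever $b$ is in its beta-set so is $b-s$. For an $s$-core $\lambda$ and each $i\in\{0,\dots,s-1\}$, let $a_i$ be the smallest integer congruent to $i$ modulo $s$ not in the beta-set of $\lambda$; set $\mathcal{Q}(\lambda)=\{a_0,\dots,a_{s-1}\}$. (This is a set of $s$ integers, pairwise incongruent mod $s$, with sum $\binom s2$.) -}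

module Defs where

open import Data.Nat as ℕ using (ℕ; zero; suc; _<_; _≥_)
open import Data.Integer as ℤ using (ℤ; +_; _-_)
open import Data.Integer.Divisibility using () renaming (_∣_ to _∣ℤ_)
open import Data.List using (List; []; _∷_)
open import Data.Nat.ListAction using (sum)
open import Data.List.Relation.Unary.All using (All)
open import Data.List.Relation.Unary.Linked using (Linked)
open import Data.Product using (Σ; ∃; ∃-syntax; _×_; _,_)
open import Relation.Binary.PropositionalEquality using (_≡_)
open import Relation.Binary.Construct.Closure.ReflexiveTransitive using (Star)
open import Relation.Nullary using (¬_)

-- A partition: a finite weakly decreasing list of positive parts
-- (λ₁ ≥ λ₂ ≥ … > 0); all later parts are implicitly 0.
record Partition : Set where
  constructor mkPartition
  field
    parts      : List ℕ
    decreasing : Linked _≥_ parts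
    positive   : All (0 <_) parts
open Partition public

-- λ at 0-indexed row k (i.e. λ_{k+1}), 0 beyond the list.
partAt : List ℕ → ℕ → ℕ
partAt []       _       = 0
partAt (x ∷ xs) zero    = x
partAt (x ∷ xs) (suc k) = partAt xs k

part : Partition → ℕ → ℕ
part λp k = partAt (parts λp) k

size : Partition → ℕ
size λp = sum (parts λp)

-- Boxes are 0-indexed: (i , j) ∈ [λ] iff j < λ_{i+1}.
Box : Set
Box = ℕ × ℕ

_∈D_ : Box → Partition → Set
(i , j) ∈D λp = j < part λp i

data Adjacent : Box → Box → Set where
  right : ∀ i j → Adjacent (i , j) (i , suc j)
  left  : ∀ i j → Adjacent (i , suc j) (i , j)
  down  : ∀ i j → Adjacent (i , j) (suc i , j)
  up    : ∀ i j → Adjacent (suc i , j) (i , j)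

data PathIn (S : Box → Set) : Box → Box → Set where
  here  : ∀ {a} → S a → PathIn S a a
  step  : ∀ {a b c} → S a → Adjacent a b → PathIn S b c → PathIn S a c

Connected : (Box → Set) → Set
Connected S = ∀ a b → S a → S b → PathIn S a b

SkewBox : Partition → Partition → Box → Set
SkewBox λp ν b = b ∈D λp × ¬ (b ∈D ν)

-- ν is obtained from λ by removing a rim t-hook: [λ]\[ν] is a connected
-- set of t boxes of the rim of λ and [ν] ⊆ [λ] is a Young diagram.
RimHookRemoval : ℕ → Partition → Partition → Set
RimHookRemoval t λp ν =
  (∀ b → b ∈D ν → b ∈D λp)
  × size λp ≡ size ν ℕ.+ t
  × (∀ i j → SkewBox λp ν (i , j) → ¬ ((suc i , suc j) ∈D λp))
  × Connected (SkewBox λp ν)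

IsCore : ℕ → Partition → Set
IsCore t λp = ¬ (∃[ ν ] RimHookRemoval t λp ν)

IsCoreOf : ℕ → Partition → Partition → Set
IsCoreOf t λp ν = Star (RimHookRemoval t) λp ν × IsCore t ν

-- Beta-set {λ_i - i : i ≥ 1}; row i = k+1 with k 0-indexed.
InBeta : Partition → ℤ → Set
InBeta λp b = ∃[ k ] b ≡ (+ part λp k) - (+ suc k)

_≡_[modℤ_] : ℤ → ℤ → ℕ → Set
a ≡ b [modℤ m ] = (+ m) ∣ℤ (a - b)

InQ : ℕ → Partition → ℤ → Set
InQ s λp a = ¬ InBeta λp a × (∀ c → c ℤ.< a → c ≡ a [modℤ s ] → InBeta λp c)

-- The proof works on James' abacus: a partition with at most M parts is
-- encoded by the M bead positions κ_k + (M − 1 − k).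
--   (1) Removing a rim t-hook is moving a bead down by t onto an empty
--       position.  Hence κ is a t-core iff every bead x ≥ t has a bead at
--       x − t; every partition reaches a t-core by hook removals; the bead
--       count of each t-runner (residue class mod t) is invariant; and a
--       t-core is determined by its runner counts.
--   (2) In an s-core the beads on s-runner i fill the levels below its
--       first gap, and the gaps are exactly 𝒬(κ) shifted by M.
--   (3) The beads of s-runner i on t-runner r number ⌊(h + offset)/t⌋ for
--       the runner height h; the remainder depends only on the gap mod t.
--       Since φ permutes the gaps preserving them mod t, λ and μ have the
--       same t-runner counts, hence the same t-core.
module Submission where

open import Defs
open import Data.Nat as ℕ
  using (ℕ; zero; suc; pred; _+_; _*_; _∸_; _≤_; _<_; _≥_; z≤n; s≤s; _≟_; _≤?_; _<?_; NonZero)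
open import Data.Nat.Properties
open import Data.Nat.DivMod
open import Data.Nat.Induction using (<-rec)
open import Data.Nat.Coprimality using (Coprime; coprime-Bézout; coprime-divisor)
import Data.Nat.Coprimality as Coprimality
open import Data.Nat.GCD using (module Bézout)
import Data.Nat.Divisibility as ℕ∣
open import Data.Integer as ℤ using (ℤ)
import Data.Integer.Properties as ℤP
import Data.Integer.Divisibility as ℤ∣ᵘ
import Data.Nat.Tactic.RingSolver as ℕSolver
import Data.Integer.Tactic.RingSolver as ℤSolver
open import Algebra.Properties.CommutativeSemigroup +-commutativeSemigroup using (interchange; xy∙z≈xz∙y)
open import Data.List using (List; []; _∷_; length)
open import Data.Nat.ListAction using (sum)
open import Data.List.Relation.Unary.All as All using (All; []; _∷_)
open import Data.List.Relation.Unary.Linked as Linked using (Linked; []; [-]; _∷_)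
open import Data.Product using (Σ; ∃; ∃-syntax; _×_; _,_; proj₁; proj₂)
open import Data.Sum using (_⊎_; inj₁; inj₂)
open import Data.Empty using (⊥; ⊥-elim)
open import Relation.Nullary using (¬_; Dec; yes; no)
open import Relation.Nullary.Decidable using (_×-dec_; ¬?)
open import Relation.Binary.PropositionalEquality
open import Relation.Binary.Definitions using (tri<; tri≈; tri>)
open import Relation.Binary.Construct.Closure.ReflexiveTransitive using (Star; ε; _◅_)
open import Function using (_∘_)

Σ< : ℕ → (ℕ → ℕ) → ℕ
Σ< zero    f = 0
Σ< (suc n) f = Σ< n f + f n

Σ-ext : ∀ n {f g : ℕ → ℕ} → (∀ k → k < n → f k ≡ g k) → Σ< n f ≡ Σ< n g
Σ-ext zero    eq = refl
Σ-ext (suc n) eq = cong₂ _+_ (Σ-ext n (λ k k<n → eq k (m<n⇒m<1+n k<n))) (eq n (n<1+n n))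

Σ-zero : ∀ n (f : ℕ → ℕ) → (∀ k → k < n → f k ≡ 0) → Σ< n f ≡ 0
Σ-zero zero    f z = refl
Σ-zero (suc n) f z rewrite Σ-zero n f (λ k k<n → z k (m<n⇒m<1+n k<n)) | z n (n<1+n n) = refl

Σ-+ : ∀ n (f g : ℕ → ℕ) → Σ< n (λ k → f k + g k) ≡ Σ< n f + Σ< n g
Σ-+ zero    f g = refl
Σ-+ (suc n) f g rewrite Σ-+ n f g = interchange (Σ< n f) (Σ< n g) (f n) (g n)

Σ-* : ∀ n c (f : ℕ → ℕ) → Σ< n (λ k → c * f k) ≡ c * Σ< n f
Σ-* zero    c f = sym (*-zeroʳ c)
Σ-* (suc n) c f rewrite Σ-* n c f = sym (*-distribˡ-+ c (Σ< n f) (f n))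

Σ-head : ∀ n (f : ℕ → ℕ) → Σ< (suc n) f ≡ f 0 + Σ< n (λ k → f (suc k))
Σ-head zero    f = +-comm 0 (f 0)
Σ-head (suc n) f rewrite Σ-head n f = +-assoc (f 0) (Σ< n (λ k → f (suc k))) (f (suc n))

Σ-split : ∀ a b (f : ℕ → ℕ) → Σ< (a + b) f ≡ Σ< a f + Σ< b (λ k → f (a + k))
Σ-split a zero    f rewrite +-identityʳ a = sym (+-identityʳ _)
Σ-split a (suc b) f rewrite +-suc a b | Σ-split a b f =
  +-assoc (Σ< a f) (Σ< b (λ k → f (a + k))) (f (a + b))

Σ-ones : ∀ n → Σ< n (λ _ → 1) ≡ n
Σ-ones zero    = refl
Σ-ones (suc n) = trans (cong (_+ 1) (Σ-ones n)) (+-comm n 1)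

Σ-swap : ∀ m n (f : ℕ → ℕ → ℕ) →
  Σ< m (λ i → Σ< n (λ j → f i j)) ≡ Σ< n (λ j → Σ< m (λ i → f i j))
Σ-swap zero    n f = sym (Σ-zero n _ (λ _ _ → refl))
Σ-swap (suc m) n f rewrite Σ-swap m n f = sym (Σ-+ n (λ j → Σ< m (λ i → f i j)) (λ j → f m j))

Σ-blocks : ∀ m t (f : ℕ → ℕ) → Σ< (m * t) f ≡ Σ< m (λ q → Σ< t (λ i → f (q * t + i)))
Σ-blocks zero    t f = refl
Σ-blocks (suc m) t f = begin
  Σ< (t + m * t) f                                ≡⟨ cong (λ n → Σ< n f) (+-comm t (m * t)) ⟩
  Σ< (m * t + t) f                                ≡⟨ Σ-split (m * t) t f ⟩
  Σ< (m * t) f + Σ< t (λ i → f (m * t + i))       ≡⟨ cong (_+ Σ< t (λ i → f (m * t + i))) (Σ-blocks m t f) ⟩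
  Σ< m (λ q → Σ< t (λ i → f (q * t + i))) + Σ< t (λ i → f (m * t + i)) ∎
  where open ≡-Reasoning

χ : ℕ → ℕ → ℕ
χ a b with a ≟ b
... | yes _ = 1
... | no  _ = 0

χ-yes : ∀ {a b} → a ≡ b → χ a b ≡ 1
χ-yes {a} {b} e with a ≟ b
... | yes _ = refl
... | no ne = ⊥-elim (ne e)

χ-no : ∀ {a b} → ¬ a ≡ b → χ a b ≡ 0
χ-no {a} {b} ne with a ≟ b
... | yes e = ⊥-elim (ne e)
... | no _  = refl

χ-sym : ∀ a b → χ a b ≡ χ b a
χ-sym a b with a ≟ b
... | yes e = sym (χ-yes (sym e))
... | no ne = sym (χ-no (ne ∘ sym))

Σ-point : ∀ n k₀ (h : ℕ → ℕ) → k₀ < n → Σ< n (λ k → χ k k₀ * h k) ≡ h k₀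
Σ-point (suc n) k₀ h k₀<1+n with k₀ ≟ n
... | yes refl rewrite Σ-zero n (λ k → χ k k₀ * h k)
                         (λ k k<n → cong (_* h k) (χ-no (λ e → <-irrefl e k<n)))
                     | χ-yes {k₀} refl = +-identityʳ (h k₀)
... | no k₀≢n rewrite Σ-point n k₀ h (≤∧≢⇒< (≤-pred k₀<1+n) k₀≢n)
                    | χ-no {n} {k₀} (λ e → k₀≢n (sym e)) = +-identityʳ (h k₀)

module BoundedSearch (P : ℕ → Set) (P? : ∀ k → Dec (P k)) where

  Below : ℕ → Set
  Below n = ∃ λ k → k < n × P k

  any<? : ∀ n → Dec (Below n)
  any<? zero = no (λ { (k , () , _) })
  any<? (suc n) with P? n | any<? n
  ... | yes p | _                  = yes (n , n<1+n n , p)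
  ... | no _  | yes (k , k<n , p)  = yes (k , m<n⇒m<1+n k<n , p)
  ... | no ¬p | no ¬below          = no absent
    where
    absent : ¬ Below (suc n)
    absent (k , k<1+n , p) with k ≟ n
    ... | yes refl = ¬p p
    ... | no k≢n   = ¬below (k , ≤∧≢⇒< (≤-pred k<1+n) k≢n , p)

  least : ∀ n → Below n → ∃ λ k → k < n × P k × (∀ j → j < k → ¬ P j)
  least (suc n) (k , k<1+n , p) with any<? n
  ... | yes below = let (k′ , k′<n , p′ , min) = least n below in k′ , m<n⇒m<1+n k′<n , p′ , min
  ... | no ¬below with k ≟ n
  ...   | yes refl = k , k<1+n , p , λ j j<k pj → ¬below (j , j<k , pj)
  ...   | no k≢n   = ⊥-elim (¬below (k , ≤∧≢⇒< (≤-pred k<1+n) k≢n , p))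

  greatest : ∀ n → Below n → ∃ λ k → k < n × P k × (∀ j → k < j → j < n → ¬ P j)
  greatest (suc n) (k , k<1+n , p) with P? n
  ... | yes pn = n , n<1+n n , pn , λ j n<j j<1+n _ → <-irrefl refl (<-≤-trans n<j (≤-pred j<1+n))
  ... | no ¬pn with k ≟ n
  ...   | yes refl = ⊥-elim (¬pn p)
  ...   | no k≢n   =
          let (k′ , k′<n , p′ , max) = greatest n (k , ≤∧≢⇒< (≤-pred k<1+n) k≢n , p)
          in k′ , m<n⇒m<1+n k′<n , p′ , above k′ max
    where
    above : ∀ k′ → (∀ j → k′ < j → j < n → ¬ P j) → ∀ j → k′ < j → j < suc n → ¬ P j
    above k′ max j k′<j j<1+n pj with j ≟ n
    ... | yes refl = ¬pn pj
    ... | no j≢n   = max j k′<j (≤∧≢⇒< (≤-pred j<1+n) j≢n) pj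

-- Partitions as weakly decreasing functions ℕ → ℕ with finite support.

len : Partition → ℕ
len κ = length (parts κ)

partAt-beyond : ∀ l k → length l ≤ k → partAt l k ≡ 0
partAt-beyond []      k       _         = refl
partAt-beyond (x ∷ l) (suc k) (s≤s l≤k) = partAt-beyond l k l≤k

partAt-pos : ∀ {l} → All (0 <_) l → ∀ k → k < length l → 0 < partAt l k
partAt-pos (px ∷ _)  zero    _         = px
partAt-pos (_ ∷ pxs) (suc k) (s≤s k<l) = partAt-pos pxs k k<l

partAt-suc : ∀ {l} → Linked _≥_ l → ∀ k → partAt l (suc k) ≤ partAt l k
partAt-suc []        k       = z≤n
partAt-suc [-]       k       = z≤n
partAt-suc (x≥y ∷ _) zero    = x≥y
partAt-suc (_ ∷ lk)  (suc k) = partAt-suc lk k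

part-pos : ∀ κ k → k < len κ → 0 < part κ k
part-pos κ = partAt-pos (positive κ)

part-beyond : ∀ κ k → len κ ≤ k → part κ k ≡ 0
part-beyond κ = partAt-beyond (parts κ)

part-suc : ∀ κ k → part κ (suc k) ≤ part κ k
part-suc κ = partAt-suc (decreasing κ)

Decreasing : (ℕ → ℕ) → Set
Decreasing f = ∀ k → f (suc k) ≤ f k

decreasing-mono : ∀ f → Decreasing f → ∀ {k k′} → k ≤ k′ → f k′ ≤ f k
decreasing-mono f dec {k} {k′} k≤k′ with ≤⇒≤′ k≤k′
... | ℕ.≤′-refl = ≤-refl
... | ℕ.≤′-step {n = n} k≤′n = ≤-trans (dec n) (decreasing-mono f dec (≤′⇒≤ k≤′n))

part-mono : ∀ κ {k k′} → k ≤ k′ → part κ k′ ≤ part κ k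
part-mono κ = decreasing-mono (part κ) (part-suc κ)

part-pos⇒ : ∀ κ k → 0 < part κ k → k < len κ
part-pos⇒ κ k pos with k <? len κ
... | yes k<len = k<len
... | no k≮len rewrite part-beyond κ k (≮⇒≥ k≮len) = ⊥-elim (<-irrefl refl pos)

len≤ : ∀ κ M → (∀ k → M ≤ k → part κ k ≡ 0) → len κ ≤ M
len≤ κ M z with len κ ≤? M
... | yes len≤M = len≤M
... | no len≰M  = ⊥-elim (<-irrefl (sym (z M ≤-refl)) (part-pos κ M (≰⇒> len≰M)))

size-Σ : ∀ κ M → len κ ≤ M → size κ ≡ Σ< M (part κ)
size-Σ κ = sumList (parts κ)
  where
  sumList : ∀ l M → length l ≤ M → sum l ≡ Σ< M (partAt l)
  sumList []      M       _         = sym (Σ-zero M (partAt []) (λ _ _ → refl))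
  sumList (x ∷ l) (suc M) (s≤s l≤M) rewrite Σ-head M (partAt (x ∷ l)) = cong (x +_) (sumList l M l≤M)

partAt-ext : ∀ {l l′} → All (0 <_) l → All (0 <_) l′ → (∀ k → partAt l k ≡ partAt l′ k) → l ≡ l′
partAt-ext []        []         eq = refl
partAt-ext []        (py ∷ _)   eq = ⊥-elim (<-irrefl (eq 0) py)
partAt-ext (px ∷ _)  []         eq = ⊥-elim (<-irrefl (sym (eq 0)) px)
partAt-ext (_ ∷ pxs) (_ ∷ pys)  eq = cong₂ _∷_ (eq 0) (partAt-ext pxs pys (eq ∘ suc))

part-ext : ∀ κ ν → (∀ k → part κ k ≡ part ν k) → κ ≡ ν
part-ext (mkPartition l d p) (mkPartition l′ d′ p′) eq with partAt-ext p p′ eq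
... | refl = cong₂ (mkPartition l) (Linked.irrelevant ≤-irrelevant d d′) (All.irrelevant ≤-irrelevant p p′)

module FromSequence (L : ℕ) (f : ℕ → ℕ) (dec : Decreasing f) (vanish : ∀ k → L ≤ k → f k ≡ 0) where

  private
    build : ℕ → (ℕ → ℕ) → List ℕ
    build zero    g = []
    build (suc n) g with g 0
    ... | zero  = []
    ... | suc x = suc x ∷ build n (g ∘ suc)

    build-at : ∀ n g → Decreasing g → (∀ k → n ≤ k → g k ≡ 0) → ∀ k → partAt (build n g) k ≡ g k
    build-at zero    g _   z k = sym (z k z≤n)
    build-at (suc n) g dec z k with g 0 in eq
    ... | zero  = sym (n≤0⇒n≡0 (subst (g k ≤_) eq (decreasing-mono g dec z≤n)))
    ... | suc x with k
    ...   | zero   = sym eq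
    ...   | suc k′ = build-at n (g ∘ suc) (dec ∘ suc) (λ k n≤k → z (suc k) (s≤s n≤k)) k′

    build-pos : ∀ n g → All (0 <_) (build n g)
    build-pos zero    g = []
    build-pos (suc n) g with g 0
    ... | zero  = []
    ... | suc x = s≤s z≤n ∷ build-pos n (g ∘ suc)

    linked : ∀ {l} → (∀ k → partAt l (suc k) ≤ partAt l k) → All (0 <_) l → Linked _≥_ l
    linked {[]}          _   _        = []
    linked {x ∷ []}      _   _        = [-]
    linked {x ∷ y ∷ l}   dec (_ ∷ ps) = dec 0 ∷ linked (dec ∘ suc) ps

    at : ∀ k → partAt (build L f) k ≡ f k
    at = build-at L f dec vanish

  partition : Partition
  partition = mkPartition (build L f)
    (linked (λ k → subst₂ _≤_ (sym (at (suc k))) (sym (at k)) (dec k)) (build-pos L f))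
    (build-pos L f)

  part-partition : ∀ k → part partition k ≡ f k
  part-partition = at

-- James' abacus with M beads: a partition κ with len κ ≤ M is encoded by
-- the bead positions  κ_k + (M − 1 − k)  for rows k < M.  Shifted by −M
-- these are the elements κ_k − (k + 1) of the beta-set of κ.
bead : Partition → ℕ → ℕ → ℕ
bead κ M k = part κ k + (M ∸ suc k)

∸-step : ∀ M k → suc k < M → M ∸ suc k ≡ suc (M ∸ suc (suc k))
∸-step M k = +-∸-assoc 1

StrictlyDecreasing : (ℕ → ℕ) → ℕ → Set
StrictlyDecreasing f M = ∀ k → suc k < M → f (suc k) < f k

bead-decreasing : ∀ κ M → StrictlyDecreasing (bead κ M) M
bead-decreasing κ M k 1+k<M rewrite ∸-step M k 1+k<M
                                  | +-suc (part κ k) (M ∸ suc (suc k)) =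
  s≤s (+-monoˡ-≤ (M ∸ suc (suc k)) (part-suc κ k))

module _ (f : ℕ → ℕ) (M : ℕ) (sd : StrictlyDecreasing f M) where

  strictly-decreasing-< : ∀ {k k′} → k < k′ → k′ < M → f k′ < f k
  strictly-decreasing-< {k} {suc k′} (s≤s k≤k′) 1+k′<M with m≤n⇒m<n∨m≡n k≤k′
  ... | inj₂ refl = sd k 1+k′<M
  ... | inj₁ k<k′ = <-trans (sd k′ 1+k′<M) (strictly-decreasing-< k<k′ (<-trans (n<1+n k′) 1+k′<M))

  strictly-decreasing-inj : ∀ {k k′} → k < M → k′ < M → f k ≡ f k′ → k ≡ k′
  strictly-decreasing-inj {k} {k′} k<M k′<M e with <-cmp k k′
  ... | tri≈ _ k≡k′ _ = k≡k′
  ... | tri< k<k′ _ _ = ⊥-elim (<-irrefl (sym e) (strictly-decreasing-< k<k′ k′<M))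
  ... | tri> _ _ k′<k = ⊥-elim (<-irrefl e (strictly-decreasing-< k′<k k<M))

-- Only f i₀ and g i₁ are unmatched.
record RowShift (f g : ℕ → ℕ) (M : ℕ) : Set where
  field
    i₀ i₁  : ℕ
    i₀≤i₁  : i₀ ≤ i₁
    i₁<M   : i₁ < M
    below  : ∀ k → k < i₀ → g k ≡ f k
    middle : ∀ k → i₀ ≤ k → k < i₁ → g k ≡ f (suc k)
    above  : ∀ k → i₁ < k → k < M → g k ≡ f k

module _ {f g M} (shift : RowShift f g M) where
  open RowShift shift

  -- The multiset of positions changes only by replacing f i₀ with g i₁,
  -- so every additive statistic h changes accordingly.
  shift-sum : ∀ (h : ℕ → ℕ) → Σ< M (h ∘ g) + h (f i₀) ≡ Σ< M (h ∘ f) + h (g i₁)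
  shift-sum h = upToM M i₁<M ≤-refl
    where
    open ≡-Reasoning

    upToi₁ : ∀ m → i₀ ≤ m → m ≤ i₁ → Σ< m (h ∘ g) + h (f i₀) ≡ Σ< (suc m) (h ∘ f)
    upToi₁ m i₀≤m m≤i₁ with i₀ ≟ m
    ... | yes refl = cong (_+ h (f i₀)) (Σ-ext i₀ (λ k k<i₀ → cong h (below k k<i₀)))
    upToi₁ zero    i₀≤m _ | no i₀≢m = ⊥-elim (i₀≢m (n≤0⇒n≡0 i₀≤m))
    upToi₁ (suc m) i₀≤m m<i₁ | no i₀≢m = begin
      Σ< m (h ∘ g) + h (g m) + h (f i₀)     ≡⟨ xy∙z≈xz∙y (Σ< m (h ∘ g)) (h (g m)) (h (f i₀)) ⟩
      Σ< m (h ∘ g) + h (f i₀) + h (g m)     ≡⟨ cong₂ _+_ (upToi₁ m i₀≤m′ (<⇒≤ m<i₁)) (cong h (middle m i₀≤m′ m<i₁)) ⟩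
      Σ< (suc m) (h ∘ f) + h (f (suc m))    ∎
      where
      i₀≤m′ : i₀ ≤ m
      i₀≤m′ = ≤-pred (≤∧≢⇒< i₀≤m i₀≢m)

    upToM : ∀ m → i₁ < m → m ≤ M → Σ< m (h ∘ g) + h (f i₀) ≡ Σ< m (h ∘ f) + h (g i₁)
    upToM (suc m) i₁<1+m 1+m≤M with i₁ ≟ m
    ... | yes refl = begin
      Σ< i₁ (h ∘ g) + h (g i₁) + h (f i₀)   ≡⟨ xy∙z≈xz∙y (Σ< i₁ (h ∘ g)) (h (g i₁)) (h (f i₀)) ⟩
      Σ< i₁ (h ∘ g) + h (f i₀) + h (g i₁)   ≡⟨ cong (_+ h (g i₁)) (upToi₁ i₁ i₀≤i₁ ≤-refl) ⟩
      Σ< (suc i₁) (h ∘ f) + h (g i₁)        ∎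
    ... | no i₁≢m = begin
      Σ< m (h ∘ g) + h (g m) + h (f i₀)     ≡⟨ xy∙z≈xz∙y (Σ< m (h ∘ g)) (h (g m)) (h (f i₀)) ⟩
      Σ< m (h ∘ g) + h (f i₀) + h (g m)     ≡⟨ cong₂ _+_ (upToM m i₁<m (<⇒≤ 1+m≤M)) (cong h (above m i₁<m 1+m≤M)) ⟩
      Σ< m (h ∘ f) + h (g i₁) + h (f m)     ≡⟨ xy∙z≈xz∙y (Σ< m (h ∘ f)) (h (g i₁)) (h (f m)) ⟩
      Σ< (suc m) (h ∘ f) + h (g i₁)         ∎
      where
      i₁<m : i₁ < m
      i₁<m = ≤∧≢⇒< (≤-pred i₁<1+m) i₁≢m

-- For abacus configurations of two partitions, the statistic "sum of
-- positions" is the size plus a constant, so a row shift relates the sizes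
-- to the two unmatched positions.
shift-size : ∀ κ ν {M} (shift : RowShift (bead κ M) (bead ν M) M) → len κ ≤ M → len ν ≤ M →
             size κ + bead ν M (RowShift.i₁ shift) ≡ size ν + bead κ M (RowShift.i₀ shift)
shift-size κ ν {M} shift lκ lν = +-cancelʳ-≡ C _ _ (begin
    size κ + g i₁ + C     ≡⟨ xy∙z≈xz∙y (size κ) (g i₁) C ⟩
    size κ + C + g i₁     ≡⟨ cong (λ x → x + C + g i₁) (size-Σ κ M lκ) ⟩
    Σ< M (part κ) + C + g i₁   ≡⟨ cong (_+ g i₁) (sym (Σ-+ M (part κ) _)) ⟩
    Σ< M f + g i₁         ≡⟨ sym (shift-sum shift (λ x → x)) ⟩
    Σ< M g + f i₀         ≡⟨ cong (_+ f i₀) (Σ-+ M (part ν) _) ⟩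
    Σ< M (part ν) + C + f i₀   ≡⟨ cong (λ x → x + C + f i₀) (sym (size-Σ ν M lν)) ⟩
    size ν + C + f i₀     ≡⟨ xy∙z≈xz∙y (size ν) C (f i₀) ⟩
    size ν + f i₀ + C     ∎)
  where
  open ≡-Reasoning
  open RowShift shift
  f g : ℕ → ℕ
  f = bead κ M
  g = bead ν M
  C : ℕ
  C = Σ< M (λ k → M ∸ suc k)

record BeadMove (t : ℕ) (f g : ℕ → ℕ) (M : ℕ) : Set where
  field
    shift : RowShift f g M
  open RowShift shift public
  field
    slide : f i₀ ≡ g i₁ + t

module _ {t f g M} (move : BeadMove t f g M) where
  open BeadMove move

  move-target-empty : StrictlyDecreasing f M → StrictlyDecreasing g M → 0 < t →
                      ∀ k → k < M → f k ≢ g i₁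
  move-target-empty sdf sdg t>0 k k<M e with <-cmp k i₀
  ... | tri< k<i₀ _ _ = <-irrefl (sym e)
          (≤-<-trans (≤-trans (m≤m+n (g i₁) t) (≤-reflexive (sym slide)))
                     (strictly-decreasing-< f M sdf k<i₀ (≤-<-trans i₀≤i₁ i₁<M)))
  ... | tri≈ _ refl _ = <-irrefl (trans (sym e) slide) (m<m+n (g i₁) t>0)
  ... | tri> _ _ i₀<k with k ≤? i₁
  ...   | no k≰i₁ = <-irrefl (trans (above k (≰⇒> k≰i₁) k<M) e) (strictly-decreasing-< g M sdg (≰⇒> k≰i₁) k<M)
  ...   | yes k≤i₁ with k
  ...     | zero   = n≮0 i₀<k
  ...     | suc k′ = <-irrefl (sym (trans (middle k′ (≤-pred i₀<k) k≤i₁) e)) (strictly-decreasing-< g M sdg k≤i₁ i₁<M)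

path-start : ∀ {S a b} → PathIn S a b → S a
path-start (here sa)     = sa
path-start (step sa _ _) = sa

path-crossing : ∀ {S a b} → PathIn S a b → ∀ i → proj₁ a ≤ i → i < proj₁ b →
                ∃ λ j → S (i , j) × S (suc i , j)
path-crossing (here _)                   i a≤i i<b = ⊥-elim (<-irrefl refl (≤-<-trans a≤i i<b))
path-crossing (step _ (right _ _) p)     i a≤i i<b = path-crossing p i a≤i i<b
path-crossing (step _ (left _ _) p)      i a≤i i<b = path-crossing p i a≤i i<b
path-crossing (step _ (up i′ _) p)       i a≤i i<b = path-crossing p i (≤-trans (n≤1+n i′) a≤i) i<b
path-crossing (step sa (down i′ j) p)    i a≤i i<b with suc i′ ≤? i
... | yes 1+i′≤i = path-crossing p i 1+i′≤i i<b
... | no 1+i′≰i with ≤-antisym a≤i (≤-pred (≰⇒> 1+i′≰i))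
...   | refl = j , sa , path-start p

module Paths {S : Box → Set} where

  _++ₚ_ : ∀ {a b c} → PathIn S a b → PathIn S b c → PathIn S a c
  here _         ++ₚ q = q
  step sa adj p  ++ₚ q = step sa adj (p ++ₚ q)

  reverse : ∀ {a b} → PathIn S a b → PathIn S b a
  reverse (here sa)        = here sa
  reverse (step sa adj p)  = reverse p ++ₚ step (path-start p) (flip adj) (here sa)
    where
    flip : ∀ {a b} → Adjacent a b → Adjacent b a
    flip (right i j) = left i j
    flip (left i j)  = right i j
    flip (down i j)  = up i j
    flip (up i j)    = down i j

  connected-via : ∀ c → (∀ a → S a → PathIn S a c) → Connected S
  connected-via c toC a b sa sb = toC a sa ++ₚ reverse (toC b sb)

module RemovalIsMove {t} (t>0 : 0 < t) (κ ν : Partition) (R : RimHookRemoval t κ ν) (M : ℕ) (lκ : len κ ≤ M) where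
  private
    ν⊆κ : ∀ b → b ∈D ν → b ∈D κ
    ν⊆κ = proj₁ R
    sizes : size κ ≡ size ν + t
    sizes = proj₁ (proj₂ R)
    rim : ∀ i j → SkewBox κ ν (i , j) → ¬ ((suc i , suc j) ∈D κ)
    rim = proj₁ (proj₂ (proj₂ R))
    connected : Connected (SkewBox κ ν)
    connected = proj₂ (proj₂ (proj₂ R))

  part-sub : ∀ k → part ν k ≤ part κ k
  part-sub k with part ν k in eq
  ... | zero  = z≤n
  ... | suc x = ν⊆κ (k , x) (subst (x <_) (sym eq) ≤-refl)

  len-sub : len ν ≤ len κ
  len-sub = len≤ ν (len κ) (λ k len≤k → n≤0⇒n≡0 (subst (part ν k ≤_) (part-beyond κ k len≤k) (part-sub k)))

  lν : len ν ≤ M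
  lν = ≤-trans len-sub lκ

  private
    Differs : ℕ → Set
    Differs k = part ν k < part κ k

    open BoundedSearch Differs (λ k → part ν k <? part κ k)

    some-row-differs : Below M
    some-row-differs with any<? M
    ... | yes d = d
    ... | no ¬d = ⊥-elim (<-irrefl (sym t≡0) t>0)
      where
      same : Σ< M (part ν) ≡ Σ< M (part κ)
      same = Σ-ext M (λ k k<M → ≤-antisym (part-sub k) (≮⇒≥ (λ d → ¬d (k , k<M , d))))
      t≡0 : t ≡ 0
      t≡0 = +-cancelˡ-≡ (size ν) t 0 (begin
        size ν + t     ≡⟨ sym sizes ⟩
        size κ         ≡⟨ size-Σ κ M lκ ⟩
        Σ< M (part κ)  ≡⟨ sym same ⟩
        Σ< M (part ν)  ≡⟨ sym (size-Σ ν M lν) ⟩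
        size ν         ≡⟨ sym (+-identityʳ _) ⟩
        size ν + 0     ∎)
        where open ≡-Reasoning

    first : ∃ λ k → k < M × Differs k × (∀ j → j < k → ¬ Differs j)
    first = least M some-row-differs
    last : ∃ λ k → k < M × Differs k × (∀ j → k < j → j < M → ¬ Differs j)
    last = greatest M some-row-differs

    i₀ i₁ : ℕ
    i₀ = proj₁ first
    i₁ = proj₁ last

    differs-i₀ : Differs i₀
    differs-i₀ = proj₁ (proj₂ (proj₂ first))
    differs-i₁ : Differs i₁
    differs-i₁ = proj₁ (proj₂ (proj₂ last))

    before-i₀ : ∀ k → k < i₀ → ¬ Differs k
    before-i₀ = proj₂ (proj₂ (proj₂ first))
    after-i₁ : ∀ k → i₁ < k → k < M → ¬ Differs k
    after-i₁ = proj₂ (proj₂ (proj₂ last))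

    i₁<M : i₁ < M
    i₁<M = <-≤-trans (part-pos⇒ κ i₁ (≤-<-trans z≤n differs-i₁)) lκ

    agree : ∀ k → ¬ Differs k → part ν k ≡ part κ k
    agree k ¬d = ≤-antisym (part-sub k) (≮⇒≥ ¬d)

    -- Between the first and last changed rows the hook is a ribbon: the
    -- path from row i₀ to row i₁ crosses each boundary k/k+1 in a column j
    -- with ν_k ≤ j < κ_{k+1}, and the rim condition forces κ_{k+1} = ν_k + 1.
    ribbon : ∀ k → i₀ ≤ k → k < i₁ → part κ (suc k) ≡ suc (part ν k)
    ribbon k i₀≤k k<i₁ with path-crossing (connected _ _ (differs-i₀ , <-irrefl refl) (differs-i₁ , <-irrefl refl)) k i₀≤k k<i₁
    ... | j , (_ , j≮νk) , (j<κk+1 , _) = ≤-antisym onRim (≤-<-trans (≮⇒≥ j≮νk) j<κk+1)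
      where
      onRim : part κ (suc k) ≤ suc (part ν k)
      onRim = ≮⇒≥ (rim k (part ν k) (≤-<-trans (≮⇒≥ j≮νk) (<-≤-trans j<κk+1 (part-suc κ k)) , <-irrefl refl))

  shift : RowShift (bead κ M) (bead ν M) M
  shift = record
    { i₀ = i₀ ; i₁ = i₁
    ; i₀≤i₁ = ≮⇒≥ (λ i₁<i₀ → before-i₀ i₁ i₁<i₀ differs-i₁)
    ; i₁<M = i₁<M
    ; below = λ k k<i₀ → cong (_+ (M ∸ suc k)) (agree k (before-i₀ k k<i₀))
    ; middle = middle
    ; above = λ k i₁<k k<M → cong (_+ (M ∸ suc k)) (agree k (after-i₁ k i₁<k k<M))
    }
    where
    middle : ∀ k → i₀ ≤ k → k < i₁ → bead ν M k ≡ bead κ M (suc k)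
    middle k i₀≤k k<i₁ rewrite ribbon k i₀≤k k<i₁ | ∸-step M k (<-≤-trans (s≤s k<i₁) i₁<M) =
      +-suc (part ν k) (M ∸ suc (suc k))

  move : BeadMove t (bead κ M) (bead ν M) M
  move = record { shift = shift ; slide = slide }
    where
    slide : bead κ M i₀ ≡ bead ν M i₁ + t
    slide = trans (+-cancelˡ-≡ (size ν) _ _ (begin
      size ν + bead κ M i₀        ≡⟨ sym (shift-size κ ν shift lκ lν) ⟩
      size κ + bead ν M i₁        ≡⟨ cong (_+ bead ν M i₁) sizes ⟩
      size ν + t + bead ν M i₁    ≡⟨ +-assoc (size ν) t _ ⟩
      size ν + (t + bead ν M i₁)  ∎)) (+-comm t _)
      where open ≡-Reasoning

-- If the bead leaves row i₀ and i₁ is the last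
-- row whose bead lies above y, the new partition ν is  κ_k (k < i₀),
-- κ_{k+1} − 1 (i₀ ≤ k < i₁),  y − (M − 1 − i₁) (k = i₁)  and  κ_k (k > i₁).
module MoveIsRemoval {t} (t>0 : 0 < t) (κ : Partition) (M : ℕ) (lκ : len κ ≤ M)
                     (y i₀ i₁ : ℕ) (y+t : y + t ≡ bead κ M i₀)
                     (i₀≤i₁ : i₀ ≤ i₁) (i₁<M : i₁ < M) (y<fi₁ : y < bead κ M i₁)
                     (beads-after-i₁ : ∀ j → i₁ < j → j < M → bead κ M j < y) where
  private
    f : ℕ → ℕ
    f = bead κ M

    -- The new part in row i₁: the bead at y = c + (M − 1 − i₁).
    c : ℕ
    c = y ∸ (M ∸ suc i₁)

    offset≤y : M ∸ suc i₁ ≤ y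
    offset≤y with suc i₁ <? M
    ... | yes 1+i₁<M rewrite ∸-step M i₁ 1+i₁<M =
            ≤-trans (s≤s (m≤n+m (M ∸ suc (suc i₁)) (part κ (suc i₁)))) (beads-after-i₁ (suc i₁) (n<1+n i₁) 1+i₁<M)
    ... | no 1+i₁≮M rewrite m≤n⇒m∸n≡0 (≮⇒≥ 1+i₁≮M) = z≤n

    c+offset : c + (M ∸ suc i₁) ≡ y
    c+offset = m∸n+n≡m offset≤y

    c<κi₁ : c < part κ i₁
    c<κi₁ = +-cancelʳ-< (M ∸ suc i₁) c (part κ i₁) (subst (_< f i₁) (sym c+offset) y<fi₁)

    κi₁+1≤c : part κ (suc i₁) ≤ c
    κi₁+1≤c with suc i₁ <? M
    ... | no 1+i₁≮M rewrite part-beyond κ (suc i₁) (≤-trans lκ (≮⇒≥ 1+i₁≮M)) = z≤n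
    ... | yes 1+i₁<M = +-cancelʳ-≤ (M ∸ suc (suc i₁)) (part κ (suc i₁)) c
            (≤-pred (subst (f (suc i₁) <_) y≡ (beads-after-i₁ (suc i₁) (n<1+n i₁) 1+i₁<M)))
      where
      y≡ : y ≡ suc (c + (M ∸ suc (suc i₁)))
      y≡ = trans (sym c+offset) (trans (cong (c +_) (∸-step M i₁ 1+i₁<M)) (+-suc c _))

    κ-pos : ∀ k → k ≤ i₁ → 0 < part κ k
    κ-pos k k≤i₁ = ≤-<-trans z≤n (<-≤-trans c<κi₁ (part-mono κ k≤i₁))

    data Row (k : ℕ) : Set where
      before : k < i₀ → Row k
      inside : i₀ ≤ k → k < i₁ → Row k
      last-row : k ≡ i₁ → Row k
      after  : i₁ < k → Row k

    row : ∀ k → Row k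
    row k with k <? i₀ | k <? i₁ | k ≟ i₁
    ... | yes k<i₀ | _        | _      = before k<i₀
    ... | no k≮i₀  | yes k<i₁ | _      = inside (≮⇒≥ k≮i₀) k<i₁
    ... | no _     | no _     | yes e  = last-row e
    ... | no _     | no k≮i₁  | no k≢i₁ = after (≤∧≢⇒< (≮⇒≥ k≮i₁) (k≢i₁ ∘ sym))

    newPart : ∀ k → Row k → ℕ
    newPart k (before _)   = part κ k
    newPart k (inside _ _) = part κ (suc k) ∸ 1
    newPart k (last-row _) = c
    newPart k (after _)    = part κ k

    -- The classification of a row is unique, so newPart does not depend on
    -- the proof of it; this lets every proof below case on rows freely.
    newPart-irrelevant : ∀ k (r r′ : Row k) → newPart k r ≡ newPart k r′
    newPart-irrelevant k (before _)       (before _)       = refl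
    newPart-irrelevant k (inside _ _)     (inside _ _)     = refl
    newPart-irrelevant k (last-row _)     (last-row _)     = refl
    newPart-irrelevant k (after _)        (after _)        = refl
    newPart-irrelevant k (before _)       (after _)        = refl
    newPart-irrelevant k (after _)        (before _)       = refl
    newPart-irrelevant k (before k<i₀)    (inside i₀≤k _)  = ⊥-elim (<⇒≱ k<i₀ i₀≤k)
    newPart-irrelevant k (inside i₀≤k _)  (before k<i₀)    = ⊥-elim (<⇒≱ k<i₀ i₀≤k)
    newPart-irrelevant k (before k<i₀)    (last-row refl)  = ⊥-elim (<⇒≱ k<i₀ i₀≤i₁)
    newPart-irrelevant k (last-row refl)  (before k<i₀)    = ⊥-elim (<⇒≱ k<i₀ i₀≤i₁)
    newPart-irrelevant k (inside _ k<i₁)  (last-row refl)  = ⊥-elim (<-irrefl refl k<i₁)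
    newPart-irrelevant k (last-row refl)  (inside _ k<i₁)  = ⊥-elim (<-irrefl refl k<i₁)
    newPart-irrelevant k (inside _ k<i₁)  (after i₁<k)     = ⊥-elim (<-asym k<i₁ i₁<k)
    newPart-irrelevant k (after i₁<k)     (inside _ k<i₁)  = ⊥-elim (<-asym k<i₁ i₁<k)
    newPart-irrelevant k (last-row refl)  (after i₁<k)     = ⊥-elim (<-irrefl refl i₁<k)
    newPart-irrelevant k (after i₁<k)     (last-row refl)  = ⊥-elim (<-irrefl refl i₁<k)

    νf : ℕ → ℕ
    νf k = newPart k (row k)

    νf≡ : ∀ k (r : Row k) → νf k ≡ newPart k r
    νf≡ k = newPart-irrelevant k (row k)

    pred< : ∀ {n} → 0 < n → n ∸ 1 < n
    pred< {suc n} _ = n<1+n n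

    newPart≤ : ∀ k (r : Row k) → newPart k r ≤ part κ k
    newPart≤ k (before _)       = ≤-refl
    newPart≤ k (inside _ _)     = ≤-trans (m∸n≤m _ 1) (part-suc κ k)
    newPart≤ k (last-row refl)  = <⇒≤ c<κi₁
    newPart≤ k (after _)        = ≤-refl

    νf≤κ : ∀ k → νf k ≤ part κ k
    νf≤κ k = newPart≤ k (row k)

    νf-dec : Decreasing νf
    νf-dec k = byRow (row k)
      where
      byRow : Row k → νf (suc k) ≤ νf k
      byRow r@(before _)    rewrite νf≡ k r = ≤-trans (νf≤κ (suc k)) (part-suc κ k)
      byRow r@(after _)     rewrite νf≡ k r = ≤-trans (νf≤κ (suc k)) (part-suc κ k)
      byRow r@(last-row refl) rewrite νf≡ k r | νf≡ (suc i₁) (after (n<1+n i₁)) = κi₁+1≤c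
      byRow r@(inside i₀≤k k<i₁) rewrite νf≡ k r = next (row (suc k))
        where
        next : Row (suc k) → νf (suc k) ≤ part κ (suc k) ∸ 1
        next r′@(inside _ _) rewrite νf≡ (suc k) r′ = ∸-monoˡ-≤ 1 (part-suc κ (suc k))
        next r′@(last-row 1+k≡i₁) rewrite νf≡ (suc k) r′ =
          ≤-pred (subst (suc c ≤_) (sym (suc-pred (part κ (suc k)) {{ℕ.>-nonZero (κ-pos (suc k) (≤-reflexive 1+k≡i₁))}}))
                                   (subst (λ i → c < part κ i) (sym 1+k≡i₁) c<κi₁))
        next (before 1+k<i₀) = ⊥-elim (<⇒≱ 1+k<i₀ (≤-trans i₀≤k (n≤1+n k)))
        next (after i₁<1+k)  = ⊥-elim (<⇒≱ i₁<1+k k<i₁)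

    νf-vanish : ∀ k → M ≤ k → νf k ≡ 0
    νf-vanish k M≤k = trans (νf≡ k (after (<-≤-trans i₁<M M≤k))) (part-beyond κ k (≤-trans lκ M≤k))

  ν : Partition
  ν = FromSequence.partition M νf νf-dec νf-vanish

  private
    pν : ∀ k (r : Row k) → part ν k ≡ newPart k r
    pν k r = trans (FromSequence.part-partition M νf νf-dec νf-vanish k) (νf≡ k r)

  lν : len ν ≤ M
  lν = len≤ ν M (λ k M≤k → trans (FromSequence.part-partition M νf νf-dec νf-vanish k) (νf-vanish k M≤k))

  private
    S : Box → Set
    S = SkewBox κ ν
    open Paths {S}

    pν′ : ∀ k → part ν k ≡ νf k
    pν′ = FromSequence.part-partition M νf νf-dec νf-vanish

    ν⊆κ : ∀ b → b ∈D ν → b ∈D κ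
    ν⊆κ (i , j) j<νi = <-≤-trans j<νi (subst (_≤ part κ i) (sym (pν′ i)) (νf≤κ i))

    skew-right : ∀ {i j} → S (i , j) → (r : Row i) → newPart i r ≤ j
    skew-right {i} {j} (_ , j≮νi) r = ≮⇒≥ (λ j<new → j≮νi (subst (j <_) (sym (pν i r)) j<new))

    skew-unchanged : ∀ {i j} → S (i , j) → (r : Row i) → newPart i r ≡ part κ i → ⊥
    skew-unchanged s@(j<κi , _) r same = <⇒≱ j<κi (subst (_≤ _) same (skew-right s r))

    rim : ∀ i j → S (i , j) → ¬ ((suc i , suc j) ∈D κ)
    rim i j s with row i
    ... | r@(before _)   = ⊥-elim (skew-unchanged s r refl)
    ... | r@(after _)    = ⊥-elim (skew-unchanged s r refl)
    ... | r@(last-row refl) = λ 1+j<κ → <⇒≱ 1+j<κ (m≤n⇒m≤1+n (≤-trans κi₁+1≤c (skew-right s r)))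
    ... | r@(inside _ i<i₁) = λ 1+j<κ → <⇒≱ 1+j<κ (lemma (κ-pos (suc i) i<i₁) (skew-right s r))
      where
      lemma : ∀ {n} → 0 < n → n ∸ 1 ≤ j → n ≤ suc j
      lemma {suc n} _ n≤j = s≤s n≤j

    walk-left : ∀ i j → S (i , j) → PathIn S (i , j) (i , part ν i)
    walk-left i j s with j ≟ part ν i
    ... | yes refl = here s
    walk-left i zero    s | no j≢ = ⊥-elim (j≢ (sym (n≤0⇒n≡0 (≮⇒≥ (proj₂ s)))))
    walk-left i (suc j) s | no j≢ = step s (left i j) (walk-left i j s′)
      where
      s′ : S (i , j)
      s′ = <-trans (n<1+n j) (proj₁ s) , λ j<νi → j≢ (≤-antisym j<νi (≮⇒≥ (proj₂ s)))

    spine : ∀ i → i₀ ≤ i → i ≤ i₁ → S (i , part ν i)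
    spine i i₀≤i i≤i₁ with row i
    ... | before i<i₀   = ⊥-elim (<⇒≱ i<i₀ i₀≤i)
    ... | after i₁<i    = ⊥-elim (<⇒≱ i₁<i i≤i₁)
    ... | r@(last-row refl) = subst (_< part κ i) (sym (pν i r)) c<κi₁ , <-irrefl refl
    ... | r@(inside _ i<i₁) =
            subst (_< part κ i) (sym (pν i r)) (<-≤-trans (pred< (κ-pos (suc i) i<i₁)) (part-suc κ i)) , <-irrefl refl

    walk-down : ∀ d i → d + i ≡ i₁ → i₀ ≤ i → PathIn S (i , part ν i) (i₁ , part ν i₁)
    walk-down zero    i refl i₀≤i = here (spine i i₀≤i ≤-refl)
    walk-down (suc d) i d+i≡ i₀≤i =
      step (spine i i₀≤i (<⇒≤ i<i₁)) (down i (part ν i))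
           (walk-left (suc i) (part ν i) below-spine ++ₚ walk-down d (suc i) (trans (+-suc d i) d+i≡) (≤-trans i₀≤i (n≤1+n i)))
      where
      i<i₁ : i < i₁
      i<i₁ = subst (i <_) d+i≡ (s≤s (m≤n+m i d))
      below-spine : S (suc i , part ν i)
      below-spine = subst (_< part κ (suc i)) (sym (pν i (inside i₀≤i i<i₁))) (pred< (κ-pos (suc i) i<i₁))
                  , λ lt → <⇒≱ lt (subst₂ _≤_ (sym (pν′ (suc i))) (sym (pν′ i)) (νf-dec i))

    to-end : ∀ a → S a → PathIn S a (i₁ , part ν i₁)
    to-end (i , j) s with row i
    ... | r@(before _) = ⊥-elim (skew-unchanged s r refl)
    ... | r@(after _)  = ⊥-elim (skew-unchanged s r refl)
    ... | last-row refl = walk-left i₁ j s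
    ... | inside i₀≤i i<i₁ = walk-left i j s ++ₚ walk-down (i₁ ∸ i) i (m∸n+n≡m (<⇒≤ i<i₁)) i₀≤i

    g : ℕ → ℕ
    g = bead ν M

    shift : RowShift f g M
    shift = record
      { i₀ = i₀ ; i₁ = i₁ ; i₀≤i₁ = i₀≤i₁ ; i₁<M = i₁<M
      ; below = λ k k<i₀ → cong (_+ (M ∸ suc k)) (pν k (before k<i₀))
      ; middle = middle
      ; above = λ k i₁<k _ → cong (_+ (M ∸ suc k)) (pν k (after i₁<k))
      }
      where
      middle : ∀ k → i₀ ≤ k → k < i₁ → g k ≡ f (suc k)
      middle k i₀≤k k<i₁ rewrite pν k (inside i₀≤k k<i₁) | ∸-step M k (≤-trans (s≤s k<i₁) i₁<M) =
        pred+suc (κ-pos (suc k) k<i₁)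
        where
        pred+suc : ∀ {n X} → 0 < n → n ∸ 1 + suc X ≡ n + X
        pred+suc {suc n} {X} _ = +-suc n X

    gi₁≡y : g i₁ ≡ y
    gi₁≡y = trans (cong (_+ (M ∸ suc i₁)) (pν i₁ (last-row refl))) c+offset

    sizes : size κ ≡ size ν + t
    sizes = +-cancelʳ-≡ (g i₁) _ _ (begin
      size κ + g i₁        ≡⟨ shift-size κ ν shift lκ lν ⟩
      size ν + f i₀        ≡⟨ cong (size ν +_) (trans (sym y+t) (cong (_+ t) (sym gi₁≡y))) ⟩
      size ν + (g i₁ + t)  ≡⟨ cong (size ν +_) (+-comm (g i₁) t) ⟩
      size ν + (t + g i₁)  ≡⟨ sym (+-assoc (size ν) t (g i₁)) ⟩
      size ν + t + g i₁    ∎)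
      where open ≡-Reasoning

  removal : RimHookRemoval t κ ν
  removal = ν⊆κ , sizes , rim , connected-via (i₁ , part ν i₁) to-end

move-removal : ∀ {t} → 0 < t → ∀ κ M → len κ ≤ M → ∀ k₀ → k₀ < M → t ≤ bead κ M k₀ →
               (∀ k → k < M → bead κ M k ≢ bead κ M k₀ ∸ t) →
               ∃ λ ν → RimHookRemoval t κ ν × len ν ≤ M
move-removal {t} t>0 κ M lκ k₀ k₀<M t≤ empty = ν , removal , lν
  where
  f : ℕ → ℕ
  f = bead κ M
  y : ℕ
  y = f k₀ ∸ t

  y<fk₀ : y < f k₀
  y<fk₀ = subst (y <_) (m∸n+n≡m t≤) (m<m+n y t>0)

  open BoundedSearch (λ k → y < f k) (λ k → y <? f k)
  last : ∃ λ k → k < M × y < f k × (∀ j → k < j → j < M → ¬ y < f j)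
  last = greatest M (k₀ , k₀<M , y<fk₀)
  i₁ : ℕ
  i₁ = proj₁ last

  beads-after-i₁ : ∀ j → i₁ < j → j < M → f j < y
  beads-after-i₁ j i₁<j j<M = ≤∧≢⇒< (≮⇒≥ (proj₂ (proj₂ (proj₂ last)) j i₁<j j<M)) (empty j j<M)

  k₀≤i₁ : k₀ ≤ i₁
  k₀≤i₁ = ≮⇒≥ (λ i₁<k₀ → <-asym (beads-after-i₁ k₀ i₁<k₀ k₀<M) y<fk₀)

  open MoveIsRemoval t>0 κ M lκ y k₀ i₁ (m∸n+n≡m t≤) k₀≤i₁ (proj₁ (proj₂ last))
                     (proj₁ (proj₂ (proj₂ last))) beads-after-i₁

AbacusCore : ℕ → (ℕ → ℕ) → ℕ → Set
AbacusCore t f M = ∀ k → k < M → t ≤ f k → ∃ λ k′ → k′ < M × f k′ ≡ f k ∸ t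

module Cores {t} (t>0 : 0 < t) (M : ℕ) where

  private
    occupied? : ∀ (f : ℕ → ℕ) z → Dec (∃ λ k → k < M × f k ≡ z)
    occupied? f z = BoundedSearch.any<? (λ k → f k ≡ z) (λ k → f k ≟ z) M

  -- A bead move by t would land on an occupied position of a core abacus.
  abacus⇒core : ∀ κ → len κ ≤ M → AbacusCore t (bead κ M) M → IsCore t κ
  abacus⇒core κ lκ core (ν , R) = move-target-empty move (bead-decreasing κ M) (bead-decreasing ν M) t>0 k′ k′<M fk′≡
    where
    open RemovalIsMove t>0 κ ν R M lκ using (move)
    open BeadMove move
    partner : ∃ λ k′ → k′ < M × bead κ M k′ ≡ bead κ M i₀ ∸ t
    partner = core i₀ (≤-<-trans i₀≤i₁ i₁<M) (subst (t ≤_) (sym slide) (m≤n+m t _))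
    k′ : ℕ
    k′ = proj₁ partner
    k′<M : k′ < M
    k′<M = proj₁ (proj₂ partner)
    fk′≡ : bead κ M k′ ≡ bead ν M i₁
    fk′≡ = trans (proj₂ (proj₂ partner)) (trans (cong (_∸ t) slide) (m+n∸n≡m _ t))

  -- An empty position x − t below a bead x would give a rim t-hook.
  core⇒abacus : ∀ κ → len κ ≤ M → IsCore t κ → AbacusCore t (bead κ M) M
  core⇒abacus κ lκ core k k<M t≤ with occupied? (bead κ M) (bead κ M k ∸ t)
  ... | yes occupied = occupied
  ... | no empty = ⊥-elim (core (proj₁ removal , proj₁ (proj₂ removal)))
    where
    removal : ∃ λ ν → RimHookRemoval t κ ν × len ν ≤ M
    removal = move-removal t>0 κ M lκ k k<M t≤ (λ k′ k′<M e → empty (k′ , k′<M , e))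

  -- Every partition reaches a t-core by removing rim t-hooks: as long as
  -- some bead can move down by t onto an empty position, move it (this
  -- removes a rim t-hook and decreases the size); otherwise the abacus,
  -- hence κ, is a t-core.
  descent : ∀ κ → len κ ≤ M → ∃ λ ν → Star (RimHookRemoval t) κ ν × IsCore t ν × len ν ≤ M
  descent κ = go (suc (size κ)) κ (n<1+n (size κ))
    where
    Reachable : Partition → Set
    Reachable κ = ∃ λ ν → Star (RimHookRemoval t) κ ν × IsCore t ν × len ν ≤ M

    Movable : Partition → ℕ → Set
    Movable κ k = t ≤ bead κ M k × ¬ (∃ λ k′ → k′ < M × bead κ M k′ ≡ bead κ M k ∸ t)

    movable? : ∀ κ k → Dec (Movable κ k)
    movable? κ k = (t ≤? bead κ M k) ×-dec ¬? (occupied? (bead κ M) (bead κ M k ∸ t))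

    go : ∀ bound κ → size κ < bound → len κ ≤ M → Reachable κ
    go (suc bound) κ size<bound lκ with BoundedSearch.any<? (Movable κ) (movable? κ) M
    ... | no nothing-movable = κ , ε , abacus⇒core κ lκ core , lκ
      where
      core : AbacusCore t (bead κ M) M
      core k k<M t≤ with occupied? (bead κ M) (bead κ M k ∸ t)
      ... | yes occupied = occupied
      ... | no empty = ⊥-elim (nothing-movable (k , k<M , t≤ , empty))
    ... | yes (k , k<M , t≤ , empty) =
      continue (move-removal t>0 κ M lκ k k<M t≤ (λ k′ k′<M e → empty (k′ , k′<M , e)))
      where
      continue : (∃ λ κ′ → RimHookRemoval t κ κ′ × len κ′ ≤ M) → Reachable κ
      continue (κ′ , R , lκ′) =
        let (ν , steps , core , lν) = go bound κ′ smaller lκ′ in ν , R ◅ steps , core , lν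
        where
        smaller : size κ′ < bound
        smaller = ≤-trans (subst (size κ′ <_) (sym (proj₁ (proj₂ R))) (m<m+n (size κ′) t>0)) (≤-pred size<bound)

runnerCount : (t : ℕ) .{{_ : NonZero t}} → ℕ → (ℕ → ℕ) → ℕ → ℕ
runnerCount t r f M = Σ< M (λ k → χ (f k % t) r)

module _ {t : ℕ} {{_ : NonZero t}} where

  -- A bead move by t keeps the moved bead on its runner.
  move-runnerCount : ∀ {f g M} → BeadMove t f g M → ∀ r → runnerCount t r g M ≡ runnerCount t r f M
  move-runnerCount {f} {g} {M} move r = +-cancelʳ-≡ (h (g i₁)) _ _ (begin
      Σ< M (h ∘ g) + h (g i₁)   ≡⟨ cong (Σ< M (h ∘ g) +_) (sym same-runner) ⟩
      Σ< M (h ∘ g) + h (f i₀)   ≡⟨ shift-sum shift h ⟩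
      Σ< M (h ∘ f) + h (g i₁)   ∎)
    where
    open ≡-Reasoning
    open BeadMove move
    h : ℕ → ℕ
    h z = χ (z % t) r
    same-runner : h (f i₀) ≡ h (g i₁)
    same-runner = cong (λ z → χ z r) (trans (cong (_% t) slide) ([m+n]%n≡m%n (g i₁) t))

  removals-runnerCount : ∀ {κ ν} M → Star (RimHookRemoval t) κ ν → len κ ≤ M → ∀ r →
                         runnerCount t r (bead ν M) M ≡ runnerCount t r (bead κ M) M
  removals-runnerCount M ε lκ r = refl
  removals-runnerCount M (_◅_ {i = κ} {j = κ′} R steps) lκ r =
    trans (removals-runnerCount M steps (≤-trans len-sub lκ) r) (move-runnerCount move r)
    where open RemovalIsMove (ℕ.>-nonZero⁻¹ t) κ κ′ R M lκ using (move; len-sub)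

occupancy : (ℕ → ℕ) → ℕ → ℕ → ℕ
occupancy f M z = Σ< M (λ k → χ (f k) z)

module _ (f : ℕ → ℕ) (M : ℕ) where

  -- Distinct beads occupy distinct positions.
  occupancy≤1 : StrictlyDecreasing f M → ∀ z → occupancy f M z ≤ 1
  occupancy≤1 sd z = go M ≤-refl
    where
    go : ∀ n → n ≤ M → Σ< n (λ k → χ (f k) z) ≤ 1
    go zero    _     = z≤n
    go (suc n) 1+n≤M = last-bead (f n ≟ z)
      where
      last-bead : Dec (f n ≡ z) → Σ< n (λ k → χ (f k) z) + χ (f n) z ≤ 1
      last-bead (no fn≢z) rewrite χ-no fn≢z | +-identityʳ (Σ< n (λ k → χ (f k) z)) = go n (<⇒≤ 1+n≤M)
      last-bead (yes fn≡z) rewrite χ-yes fn≡z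
                                 | Σ-zero n (λ k → χ (f k) z) (λ k k<n → χ-no (λ fk≡z →
                                     <-irrefl (strictly-decreasing-inj f M sd (<-trans k<n 1+n≤M) 1+n≤M
                                                                        (trans fk≡z (sym fn≡z))) k<n)) = ≤-refl

  occupied⇒ : ∀ z k → k < M → f k ≡ z → 1 ≤ occupancy f M z
  occupied⇒ z k k<M fk≡z = go M k<M
    where
    go : ∀ n → k < n → 1 ≤ Σ< n (λ k → χ (f k) z)
    go (suc n) k<1+n with k ≟ n
    ... | yes refl rewrite χ-yes fk≡z = m≤n+m 1 _
    ... | no k≢n = ≤-trans (go n (≤∧≢⇒< (≤-pred k<1+n) k≢n)) (m≤m+n _ _)

  ⇒occupied : ∀ z → 1 ≤ occupancy f M z → ∃ λ k → k < M × f k ≡ z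
  ⇒occupied z 1≤ with BoundedSearch.any<? (λ k → f k ≡ z) (λ k → f k ≟ z) M
  ... | yes occupied = occupied
  ... | no ¬occupied = ⊥-elim (<-irrefl refl (<-≤-trans 1≤ (≤-reflexive
          (Σ-zero M _ (λ k k<M → χ-no (λ fk≡z → ¬occupied (k , k<M , fk≡z)))))))

  occupancy-sum : ∀ V (h : ℕ → ℕ) → (∀ k → k < M → f k < V) →
                  Σ< V (λ z → h z * occupancy f M z) ≡ Σ< M (h ∘ f)
  occupancy-sum V h f<V = begin
    Σ< V (λ z → h z * occupancy f M z)          ≡⟨ Σ-ext V (λ z _ → sym (Σ-* M (h z) (λ k → χ (f k) z))) ⟩
    Σ< V (λ z → Σ< M (λ k → h z * χ (f k) z))   ≡⟨ Σ-swap V M _ ⟩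
    Σ< M (λ k → Σ< V (λ z → h z * χ (f k) z))   ≡⟨ Σ-ext M (λ k k<M → trans
        (Σ-ext V (λ z _ → trans (*-comm (h z) _) (cong (_* h z) (χ-sym (f k) z))))
        (Σ-point V (f k) h (f<V k k<M))) ⟩
    Σ< M (h ∘ f)                                ∎
    where open ≡-Reasoning

Σ-runner : ∀ {t} .{{_ : NonZero t}} W (B : ℕ → ℕ) r → r < t →
           Σ< (W * t) (λ z → χ (z % t) r * B z) ≡ Σ< W (λ q → B (q * t + r))
Σ-runner {t} W B r r<t = trans (Σ-blocks W t _) (Σ-ext W (λ q _ → trans
  (Σ-ext t (λ i i<t → cong (λ x → χ x r * B (q * t + i))
     (trans (cong (_% t) (+-comm (q * t) i)) (trans ([m+kn]%n≡m%n i q t) (m<n⇒m%n≡m i<t)))))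
  (Σ-point t r (λ i → B (q * t + i)) r<t)))

runnerCount-occupancy : ∀ {t} .{{_ : NonZero t}} (f : ℕ → ℕ) M W r → r < t → (∀ k → k < M → f k < W * t) →
                        runnerCount t r f M ≡ Σ< W (λ q → occupancy f M (q * t + r))
runnerCount-occupancy {t} f M W r r<t f<Wt =
  trans (sym (occupancy-sum f M (W * t) (λ z → χ (z % t) r) f<Wt)) (Σ-runner W (occupancy f M) r r<t)

-- A 0/1 sequence whose ones form an initial segment: a runner of an
-- abacus filled from the bottom up.
record Initial (b : ℕ → ℕ) : Set where
  field
    ≤1     : ∀ q → b q ≤ 1
    closed : ∀ q → b (suc q) ≡ 1 → b q ≡ 1

module _ {b : ℕ → ℕ} (ini : Initial b) where
  open Initial ini

  initial-01 : ∀ q → b q ≡ 0 ⊎ b q ≡ 1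
  initial-01 q with b q | ≤1 q
  ... | zero     | _ = inj₁ refl
  ... | suc zero | _ = inj₂ refl
  ... | suc (suc _) | s≤s ()

  private
    ones-below : ∀ n q → b n ≡ 1 → q ≤ n → b q ≡ 1
    ones-below n q bn≡1 q≤n with m≤n⇒m<n∨m≡n q≤n
    ... | inj₂ refl = bn≡1
    ones-below (suc n) q bn≡1 q≤n | inj₁ q<1+n = ones-below n q (closed n bn≡1) (≤-pred q<1+n)

    all-ones : ∀ W → b W ≡ 1 → Σ< W b ≡ W
    all-ones zero    _     = refl
    all-ones (suc W) bW≡1 rewrite all-ones W (closed W bW≡1) | closed W bW≡1 = +-comm W 1

  initial-Σ≤ : ∀ W → Σ< W b ≤ W
  initial-Σ≤ zero    = z≤n
  initial-Σ≤ (suc W) = subst (Σ< W b + b W ≤_) (+-comm W 1) (+-mono-≤ (initial-Σ≤ W) (≤1 W))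

  initial-char : ∀ W q → q < W → (b q ≡ 1 → q < Σ< W b) × (q < Σ< W b → b q ≡ 1)
  initial-char (suc W) q q<1+W with initial-01 W
  ... | inj₂ bW≡1 = (λ _ → subst (q <_) (sym total) q<1+W) , (λ _ → ones-below W q bW≡1 (≤-pred q<1+W))
    where
    total : Σ< W b + b W ≡ suc W
    total rewrite all-ones W bW≡1 | bW≡1 = +-comm W 1
  ... | inj₁ bW≡0 with q ≟ W
  ...   | yes refl = (λ bq≡1 → ⊥-elim (0≢1+n (trans (sym bW≡0) bq≡1)))
                   , (λ q<Σ → ⊥-elim (<⇒≱ q<Σ (subst (_≤ q) (sym (trans (cong (Σ< q b +_) bW≡0) (+-identityʳ _))) (initial-Σ≤ q))))
  ...   | no q≢W = let (to , from) = initial-char W q (≤∧≢⇒< (≤-pred q<1+W) q≢W)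
                       same : Σ< W b + b W ≡ Σ< W b
                       same = trans (cong (Σ< W b +_) bW≡0) (+-identityʳ _)
                   in (λ bq≡1 → subst (q <_) (sym same) (to bq≡1)) , (λ q<Σ → from (subst (q <_) same q<Σ))

  initial-weighted-sum : ∀ W (g : ℕ → ℕ) → Σ< W (λ q → g q * b q) ≡ Σ< (Σ< W b) g
  initial-weighted-sum W g = begin
    Σ< W (λ q → g q * b q)                              ≡⟨ cong (λ n → Σ< n (λ q → g q * b q)) (sym (m+[n∸m]≡n (initial-Σ≤ W))) ⟩
    Σ< (Q + (W ∸ Q)) (λ q → g q * b q)                  ≡⟨ Σ-split Q (W ∸ Q) _ ⟩
    Σ< Q (λ q → g q * b q) + Σ< (W ∸ Q) (λ k → g (Q + k) * b (Q + k))
      ≡⟨ cong₂ _+_ (Σ-ext Q (λ q q<Q → trans (cong (g q *_) (proj₂ (initial-char W q (<-≤-trans q<Q (initial-Σ≤ W))) q<Q))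
                                            (*-identityʳ (g q))))
                   (Σ-zero (W ∸ Q) _ (λ k k<W∸Q → vanishes k k<W∸Q)) ⟩
    Σ< Q g + 0                                          ≡⟨ +-identityʳ _ ⟩
    Σ< Q g                                              ∎
    where
    open ≡-Reasoning
    Q : ℕ
    Q = Σ< W b
    vanishes : ∀ k → k < W ∸ Q → g (Q + k) * b (Q + k) ≡ 0
    vanishes k k<W∸Q with initial-01 (Q + k)
    ... | inj₁ b≡0 = trans (cong (g (Q + k) *_) b≡0) (*-zeroʳ (g (Q + k)))
    ... | inj₂ b≡1 = ⊥-elim (<⇒≱ (proj₁ (initial-char W (Q + k) (subst (Q + k <_) (m+[n∸m]≡n (initial-Σ≤ W)) (+-monoʳ-< Q k<W∸Q))) b≡1)
                                 (m≤m+n Q k))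

initial-unique : ∀ {b₁ b₂} → Initial b₁ → Initial b₂ → ∀ W → Σ< W b₁ ≡ Σ< W b₂ → ∀ q → q < W → b₁ q ≡ b₂ q
initial-unique {b₁} {b₂} ini₁ ini₂ W same q q<W with initial-01 ini₁ q | initial-01 ini₂ q
... | inj₁ e₁ | inj₁ e₂ = trans e₁ (sym e₂)
... | inj₂ e₁ | inj₂ e₂ = trans e₁ (sym e₂)
... | inj₂ e₁ | inj₁ e₂ = ⊥-elim (0≢1+n (trans (sym e₂)
        (proj₂ (initial-char ini₂ W q q<W) (subst (q <_) same (proj₁ (initial-char ini₁ W q q<W) e₁)))))
... | inj₁ e₁ | inj₂ e₂ = ⊥-elim (0≢1+n (trans (sym e₁)
        (proj₂ (initial-char ini₁ W q q<W) (subst (q <_) (sym same) (proj₁ (initial-char ini₂ W q q<W) e₂)))))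

-- Two strictly decreasing sequences of M values with the same set of
-- values coincide: compare the k-th values, knowing the earlier ones agree.
same-values : ∀ (f₁ f₂ : ℕ → ℕ) M → StrictlyDecreasing f₁ M → StrictlyDecreasing f₂ M →
              (∀ k → k < M → ∃ λ k′ → k′ < M × f₂ k′ ≡ f₁ k) →
              (∀ k → k < M → ∃ λ k′ → k′ < M × f₁ k′ ≡ f₂ k) →
              ∀ k → k < M → f₁ k ≡ f₂ k
same-values f₁ f₂ M sd₁ sd₂ in₂ in₁ = <-rec (λ k → k < M → f₁ k ≡ f₂ k) agree
  where
  agree : ∀ k → (∀ {j} → j < k → j < M → f₁ j ≡ f₂ j) → k < M → f₁ k ≡ f₂ k
  agree k earlier k<M with in₂ k k<M | in₁ k k<M
  ... | m , m<M , f₂m≡f₁k | m′ , m′<M , f₁m′≡f₂k with <-cmp m k | <-cmp m′ k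
  ...   | tri≈ _ refl _ | _ = sym f₂m≡f₁k
  ...   | _ | tri≈ _ refl _ = f₁m′≡f₂k
  ...   | tri< m<k _ _ | _ = ⊥-elim (<-irrefl (strictly-decreasing-inj f₁ M sd₁ m<M k<M
                               (trans (earlier m<k m<M) f₂m≡f₁k)) m<k)
  ...   | _ | tri< m′<k _ _ = ⊥-elim (<-irrefl (strictly-decreasing-inj f₂ M sd₂ m′<M k<M
                               (trans (sym (earlier m′<k m′<M)) f₁m′≡f₂k)) m′<k)
  ...   | tri> _ _ k<m | tri> _ _ k<m′ = ⊥-elim (<-asym f₁k<f₂k f₂k<f₁k)
    where
    f₁k<f₂k : f₁ k < f₂ k
    f₁k<f₂k = subst (_< f₂ k) f₂m≡f₁k (strictly-decreasing-< f₂ M sd₂ k<m m<M)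
    f₂k<f₁k : f₂ k < f₁ k
    f₂k<f₁k = subst (_< f₁ k) f₁m′≡f₂k (strictly-decreasing-< f₁ M sd₁ k<m′ m′<M)

bead-bound : ∀ κ M k → bead κ M k ≤ part κ 0 + M
bead-bound κ M k = +-mono-≤ (part-mono κ z≤n) (m∸n≤m M (suc k))

module CoreRunners {t : ℕ} {{_ : NonZero t}} (M : ℕ) where

  core-runner-initial : ∀ κ r → AbacusCore t (bead κ M) M → Initial (λ q → occupancy (bead κ M) M (q * t + r))
  core-runner-initial κ r core = record
    { ≤1 = λ q → occupancy≤1 f M (bead-decreasing κ M) _
    ; closed = closed }
    where
    f : ℕ → ℕ
    f = bead κ M

    -- A bead at level q + 1 has, by the core property, a bead below it.
    closed : ∀ q → occupancy f M (suc q * t + r) ≡ 1 → occupancy f M (q * t + r) ≡ 1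
    closed q occ≡1 with ⇒occupied f M _ (≤-reflexive (sym occ≡1))
    ... | k , k<M , fk≡ with core k k<M (subst (t ≤_) (sym (trans fk≡ (+-assoc t (q * t) r))) (m≤m+n t _))
    ...   | k′ , k′<M , fk′≡ = ≤-antisym (occupancy≤1 f M (bead-decreasing κ M) _)
                                         (occupied⇒ f M _ k′ k′<M (trans fk′≡ one-level-down))
      where
      one-level-down : f k ∸ t ≡ q * t + r
      one-level-down = trans (cong (_∸ t) (trans fk≡ (+-assoc t (q * t) r))) (m+n∸m≡n t (q * t + r))

  -- A t-core is determined by its runner counts: the runners of two
  -- t-cores are filled from the bottom with equally many beads, so the two
  -- abaci have the same occupied positions, hence the same beads.
  core-unique : ∀ κ₁ κ₂ → len κ₁ ≤ M → len κ₂ ≤ M →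
                AbacusCore t (bead κ₁ M) M → AbacusCore t (bead κ₂ M) M →
                (∀ r → r < t → runnerCount t r (bead κ₁ M) M ≡ runnerCount t r (bead κ₂ M) M) → κ₁ ≡ κ₂
  core-unique κ₁ κ₂ l₁ l₂ core₁ core₂ counts = part-ext κ₁ κ₂ same-parts
    where
    f₁ f₂ : ℕ → ℕ
    f₁ = bead κ₁ M
    f₂ = bead κ₂ M
    W : ℕ
    W = suc (part κ₁ 0 + part κ₂ 0 + M)

    f₁<Wt : ∀ k → k < M → f₁ k < W * t
    f₁<Wt k _ = <-≤-trans (s≤s (≤-trans (bead-bound κ₁ M k) (+-monoˡ-≤ M (m≤m+n _ _)))) (m≤m*n W t)
    f₂<Wt : ∀ k → k < M → f₂ k < W * t
    f₂<Wt k _ = <-≤-trans (s≤s (≤-trans (bead-bound κ₂ M k) (+-monoˡ-≤ M (m≤n+m _ (part κ₁ 0))))) (m≤m*n W t)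

    same-runner : ∀ r → r < t → ∀ q → q < W → occupancy f₁ M (q * t + r) ≡ occupancy f₂ M (q * t + r)
    same-runner r r<t = initial-unique (core-runner-initial κ₁ r core₁) (core-runner-initial κ₂ r core₂) W
      (trans (sym (runnerCount-occupancy f₁ M W r r<t f₁<Wt))
             (trans (counts r r<t) (runnerCount-occupancy f₂ M W r r<t f₂<Wt)))

    same-occupancy : ∀ z → z < W * t → occupancy f₁ M z ≡ occupancy f₂ M z
    same-occupancy z z<Wt = subst (λ x → occupancy f₁ M x ≡ occupancy f₂ M x) z≡
      (same-runner (z % t) (m%n<n z t) (z / t) (m<n*o⇒m/o<n z<Wt))
      where
      z≡ : z / t * t + z % t ≡ z
      z≡ = trans (+-comm (z / t * t) (z % t)) (sym (m≡m%n+[m/n]*n z t))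

    in₂ : ∀ k → k < M → ∃ λ k′ → k′ < M × f₂ k′ ≡ f₁ k
    in₂ k k<M = ⇒occupied f₂ M (f₁ k) (subst (1 ≤_) (same-occupancy (f₁ k) (f₁<Wt k k<M)) (occupied⇒ f₁ M (f₁ k) k k<M refl))
    in₁ : ∀ k → k < M → ∃ λ k′ → k′ < M × f₁ k′ ≡ f₂ k
    in₁ k k<M = ⇒occupied f₁ M (f₂ k) (subst (1 ≤_) (sym (same-occupancy (f₂ k) (f₂<Wt k k<M))) (occupied⇒ f₂ M (f₂ k) k k<M refl))

    same-parts : ∀ k → part κ₁ k ≡ part κ₂ k
    same-parts k with k <? M
    ... | yes k<M = +-cancelʳ-≡ (M ∸ suc k) _ _ (same-values f₁ f₂ M (bead-decreasing κ₁ M) (bead-decreasing κ₂ M) in₂ in₁ k k<M)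
    ... | no k≮M = trans (part-beyond κ₁ k (≤-trans l₁ (≮⇒≥ k≮M))) (sym (part-beyond κ₂ k (≤-trans l₂ (≮⇒≥ k≮M))))

-- Partitions with the same t-runner counts on a common abacus have the same
-- t-core: remove rim t-hooks down to t-cores, which keeps the runner counts,
-- and a t-core is determined by its runner counts.
same-t-core : ∀ {t} {{_ : NonZero t}} (κ₁ κ₂ : Partition) M → len κ₁ ≤ M → len κ₂ ≤ M →
              (∀ r → r < t → runnerCount t r (bead κ₁ M) M ≡ runnerCount t r (bead κ₂ M) M) →
              ∃[ ν ] (IsCoreOf t κ₁ ν × IsCoreOf t κ₂ ν)
same-t-core {t} κ₁ κ₂ M l₁ l₂ counts with Cores.descent (ℕ.>-nonZero⁻¹ t) M κ₁ l₁ | Cores.descent (ℕ.>-nonZero⁻¹ t) M κ₂ l₂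
... | ν₁ , κ₁↝ν₁ , core₁ , lν₁ | ν₂ , κ₂↝ν₂ , core₂ , lν₂ =
  ν₁ , (κ₁↝ν₁ , core₁) , subst (IsCoreOf t κ₂) (sym ν₁≡ν₂) (κ₂↝ν₂ , core₂)
  where
  open Cores (ℕ.>-nonZero⁻¹ t) M using (core⇒abacus)
  ν₁≡ν₂ : ν₁ ≡ ν₂
  ν₁≡ν₂ = CoreRunners.core-unique M ν₁ ν₂ lν₁ lν₂ (core⇒abacus ν₁ lν₁ core₁) (core⇒abacus ν₂ lν₂ core₂)
    (λ r r<t → trans (removals-runnerCount M κ₁↝ν₁ l₁ r) (trans (counts r r<t) (sym (removals-runnerCount M κ₂↝ν₂ l₂ r))))

module Modular (t : ℕ) {{_ : NonZero t}} where

  infix 4 _≋_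
  _≋_ : ℕ → ℕ → Set
  a ≋ b = a % t ≡ b % t

  ≋-+ : ∀ {a b c d} → a ≋ b → c ≋ d → a + c ≋ b + d
  ≋-+ {a} {b} {c} {d} a≋b c≋d = begin
    (a + c) % t          ≡⟨ %-distribˡ-+ a c t ⟩
    (a % t + c % t) % t  ≡⟨ cong₂ (λ x y → (x + y) % t) a≋b c≋d ⟩
    (b % t + d % t) % t  ≡⟨ sym (%-distribˡ-+ b d t) ⟩
    (b + d) % t          ∎
    where open ≡-Reasoning

  ≋-*ʳ : ∀ {a b} c → a ≋ b → a * c ≋ b * c
  ≋-*ʳ {a} {b} c a≋b = begin
    (a * c) % t          ≡⟨ %-distribˡ-* a c t ⟩
    (a % t * (c % t)) % t ≡⟨ cong (λ x → (x * (c % t)) % t) a≋b ⟩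
    (b % t * (c % t)) % t ≡⟨ sym (%-distribˡ-* b c t) ⟩
    (b * c) % t          ∎
    where open ≡-Reasoning

  ≋-multiple : ∀ a k → a + k * t ≋ a
  ≋-multiple a k = [m+kn]%n≡m%n a k t

  ∣⇒≋ : ∀ {a b} → a ≤ b → t ℕ∣.∣ b ∸ a → a ≋ b
  ∣⇒≋ {a} {b} a≤b (ℕ∣.divides k b∸a≡kt) = sym (begin
    b % t                ≡⟨ cong (_% t) (sym (m+[n∸m]≡n a≤b)) ⟩
    (a + (b ∸ a)) % t    ≡⟨ cong (λ x → (a + x) % t) b∸a≡kt ⟩
    (a + k * t) % t      ≡⟨ ≋-multiple a k ⟩
    a % t                ∎)
    where open ≡-Reasoning

  ≋⇒∣ : ∀ {a b} → a ≋ b → t ℕ∣.∣ b ∸ a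
  ≋⇒∣ {a} {b} a≋b = ℕ∣.divides (b / t ∸ a / t) (begin
    b ∸ a                                   ≡⟨ cong₂ _∸_ (m≡m%n+[m/n]*n b t) (m≡m%n+[m/n]*n a t) ⟩
    (b % t + b / t * t) ∸ (a % t + a / t * t) ≡⟨ cong (λ x → (b % t + b / t * t) ∸ (x + a / t * t)) a≋b ⟩
    (b % t + b / t * t) ∸ (b % t + a / t * t) ≡⟨ [m+n]∸[m+o]≡n∸o (b % t) _ _ ⟩
    b / t * t ∸ a / t * t                   ≡⟨ sym (*-distribʳ-∸ t (b / t) (a / t)) ⟩
    (b / t ∸ a / t) * t                     ∎)
    where open ≡-Reasoning

  private
    by-order : ∀ {P : ℕ → ℕ → Set} → (∀ {a b} → P a b → P b a) →
               (∀ {a b} → a ≤ b → P a b → a ≋ b) → ∀ {a b} → P a b → a ≋ b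
    by-order P-sym ordered {a} {b} p with ≤-total a b
    ... | inj₁ a≤b = ordered a≤b p
    ... | inj₂ b≤a = sym (ordered b≤a (P-sym p))

  ≋-cancel-+ʳ : ∀ c {a b} → a + c ≋ b + c → a ≋ b
  ≋-cancel-+ʳ c = by-order sym (λ {a} {b} a≤b ac≋bc → ∣⇒≋ a≤b
    (subst (t ℕ∣.∣_) (trans (cong₂ _∸_ (+-comm b c) (+-comm a c)) ([m+n]∸[m+o]≡n∸o c b a)) (≋⇒∣ ac≋bc)))

  ≋-cancel-*ʳ : ∀ {s} → Coprime t s → ∀ {a b} → a * s ≋ b * s → a ≋ b
  ≋-cancel-*ʳ {s} t⊥s = by-order sym (λ {a} {b} a≤b as≋bs → ∣⇒≋ a≤b (coprime-divisor t⊥s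
    (subst (t ℕ∣.∣_) (trans (sym (*-distribʳ-∸ s b a)) (*-comm (b ∸ a) s)) (≋⇒∣ as≋bs))))

  inverse : ∀ s → Coprime s t → ∃ λ u → u * s ≋ 1
  inverse s s⊥t with coprime-Bézout s⊥t
  ... | Bézout.+- x y 1+yt≡xs = x , trans (cong (_% t) (sym 1+yt≡xs)) (≋-multiple 1 y)
  ... | Bézout.-+ x y 1+xs≡yt = pred t * x , (begin
    (pred t * x * s) % t                 ≡⟨ sym (≋-multiple (pred t * x * s) y) ⟩
    (pred t * x * s + y * t) % t         ≡⟨ cong (λ z → (pred t * x * s + z) % t) (sym 1+xs≡yt) ⟩
    (pred t * x * s + (1 + x * s)) % t   ≡⟨ cong (_% t) (identity (pred t) x s) ⟩
    (1 + x * s * suc (pred t)) % t       ≡⟨ cong (λ z → (1 + x * s * z) % t) (suc-pred t) ⟩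
    (1 + x * s * t) % t                  ≡⟨ ≋-multiple 1 (x * s) ⟩
    1 % t                                ∎)
    where
    open ≡-Reasoning
    identity : ∀ p x s → p * x * s + (1 + x * s) ≡ 1 + x * s * suc p
    identity = ℕSolver.solve-∀

module _ {t : ℕ} {{_ : NonZero t}} where
  open Modular t

  suc-% : ∀ n → suc n % t ≢ 0 → suc n % t ≡ suc (n % t)
  suc-% n 1+n%t≢0 with suc (n % t) <? t
  ... | yes 1+n%t<t = begin
    suc n % t                      ≡⟨ cong (λ x → suc x % t) (m≡m%n+[m/n]*n n t) ⟩
    (suc (n % t) + n / t * t) % t  ≡⟨ ≋-multiple (suc (n % t)) (n / t) ⟩
    suc (n % t) % t                ≡⟨ m<n⇒m%n≡m 1+n%t<t ⟩
    suc (n % t)                    ∎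
    where open ≡-Reasoning
  ... | no 1+n%t≮t = ⊥-elim (1+n%t≢0 (trans (cong (_% t) 1+n≡) (m*n%n≡0 (suc (n / t)) t)))
    where
    1+n≡ : suc n ≡ suc (n / t) * t
    1+n≡ = trans (cong suc (m≡m%n+[m/n]*n n t)) (cong (_+ n / t * t) (≤-antisym (m%n<n n t) (≮⇒≥ 1+n%t≮t)))

  -- Counting a residue class: among q < Q exactly ⌊(Q + d)/t⌋ satisfy
  -- q ≡ j (mod t), where d = t − 1 − j; in division-free form,
  -- t · #{q < Q | q ≡ j} + (Q + d) mod t = Q + d.
  module _ (j : ℕ) (j<t : j < t) where
    private
      d : ℕ
      d = t ∸ suc j

      1+d≡ : suc d ≡ t ∸ j
      1+d≡ = sym (+-∸-assoc 1 j<t)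

      0%t≡0 : 0 % t ≡ 0
      0%t≡0 = m<n⇒m%n≡m (ℕ.>-nonZero⁻¹ t)

      j%t≡j : j % t ≡ j
      j%t≡j = m<n⇒m%n≡m j<t

      j+[t∸j]≋0 : j + (t ∸ j) ≋ 0
      j+[t∸j]≋0 = trans (cong (_% t) (m+[n∸m]≡n (<⇒≤ j<t))) (trans (n%n≡0 t) (sym 0%t≡0))

      shift : ∀ q → suc (q + d) ≡ q + (t ∸ j)
      shift q = trans (sym (+-suc q d)) (cong (q +_) 1+d≡)

      in-class⇒ : ∀ q → q % t ≡ j → suc (q + d) % t ≡ 0
      in-class⇒ q q≡j = trans (cong (_% t) (shift q))
        (trans (≋-+ (trans q≡j (sym j%t≡j)) (refl {x = (t ∸ j) % t})) (trans j+[t∸j]≋0 0%t≡0))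

      in-class⇐ : ∀ q → suc (q + d) % t ≡ 0 → q % t ≡ j
      in-class⇐ q 0≡ = trans (≋-cancel-+ʳ (t ∸ j)
        (trans (cong (_% t) (sym (shift q))) (trans 0≡ (trans (sym 0%t≡0) (sym j+[t∸j]≋0))))) j%t≡j

    residue-count : ∀ Q → t * Σ< Q (λ q → χ (q % t) j) + (Q + d) % t ≡ Q + d
    residue-count zero rewrite *-zeroʳ t = m<n⇒m%n≡m (∸-monoʳ-< {t} {suc j} {0} (s≤s z≤n) j<t)
    residue-count (suc Q) = next (Q % t ≟ j)
      where
      open ≡-Reasoning
      c : ℕ
      c = Σ< Q (λ q → χ (q % t) j)
      next : Dec (Q % t ≡ j) → t * (c + χ (Q % t) j) + suc (Q + d) % t ≡ suc (Q + d)
      next (yes Q≡j) rewrite χ-yes Q≡j = begin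
        t * (c + 1) + suc (Q + d) % t     ≡⟨ cong (t * (c + 1) +_) (in-class⇒ Q Q≡j) ⟩
        t * (c + 1) + 0                   ≡⟨ trans (+-identityʳ _) (trans (*-distribˡ-+ t c 1) (cong (t * c +_) (*-identityʳ t))) ⟩
        t * c + t                         ≡⟨ cong (t * c +_) (sym (trans (cong suc (%-pred-≡0 (in-class⇒ Q Q≡j))) (suc-pred t))) ⟩
        t * c + suc ((Q + d) % t)         ≡⟨ +-suc (t * c) _ ⟩
        suc (t * c + (Q + d) % t)         ≡⟨ cong suc (residue-count Q) ⟩
        suc (Q + d)                       ∎
      next (no Q≢j) rewrite χ-no Q≢j = begin
        t * (c + 0) + suc (Q + d) % t     ≡⟨ cong₂ _+_ (cong (t *_) (+-identityʳ c)) (suc-% (Q + d) (Q≢j ∘ in-class⇐ Q)) ⟩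
        t * c + suc ((Q + d) % t)         ≡⟨ +-suc (t * c) _ ⟩
        suc (t * c + (Q + d) % t)         ≡⟨ cong suc (residue-count Q) ⟩
        suc (Q + d)                       ∎

χ-cong : ∀ {a b c d} → (a ≡ b → c ≡ d) → (c ≡ d → a ≡ b) → χ a b ≡ χ c d
χ-cong {a} {b} {c} {d} to from with a ≟ b
... | yes a≡b = sym (χ-yes (to a≡b))
... | no a≢b  = sym (χ-no (a≢b ∘ from))

-- For coprime s and t, the positions q·s + i (q = 0, 1, …) of s-runner i
-- meet t-runner r periodically: exactly when q ≡ j₀ i (mod t).
module RunnerCrossing {s t : ℕ} {{_ : NonZero t}} (s⊥t : Coprime s t) (r : ℕ) (r<t : r < t) where
  open Modular t

  private
    u : ℕ
    u = proj₁ (inverse s s⊥t)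

    us≋1 : u * s ≋ 1
    us≋1 = proj₂ (inverse s s⊥t)

    t⊥s : Coprime t s
    t⊥s = Coprimality.sym s⊥t

    r%t≡r : r % t ≡ r
    r%t≡r = m<n⇒m%n≡m r<t

  -- j₀ i ≡ s⁻¹ (r − i): the level at which s-runner i first meets t-runner r.
  j₀ : ℕ → ℕ
  j₀ i = (u * (r + pred t * i)) % t

  j₀<t : ∀ i → j₀ i < t
  j₀<t i = m%n<n _ t

  j₀-spec : ∀ i → j₀ i * s + i ≋ r
  j₀-spec i = begin
    (j₀ i * s + i) % t                 ≡⟨ ≋-+ (≋-*ʳ s (m%n%n≡m%n (u * w) t)) (refl {x = i % t}) ⟩
    (u * w * s + i) % t                ≡⟨ cong (λ x → (x + i) % t) (regroup u w s) ⟩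
    (u * s * w + i) % t                ≡⟨ ≋-+ (≋-*ʳ w us≋1) (refl {x = i % t}) ⟩
    (1 * w + i) % t                    ≡⟨ cong (_% t) (unfold r (pred t) i) ⟩
    (r + i * suc (pred t)) % t         ≡⟨ cong (λ x → (r + i * x) % t) (suc-pred t) ⟩
    (r + i * t) % t                    ≡⟨ ≋-multiple r i ⟩
    r % t                              ∎
    where
    open ≡-Reasoning
    w : ℕ
    w = r + pred t * i
    regroup : ∀ u w s → u * w * s ≡ u * s * w
    regroup = ℕSolver.solve-∀
    unfold : ∀ r p i → 1 * (r + p * i) + i ≡ r + i * suc p
    unfold = ℕSolver.solve-∀

  on-runner⇒ : ∀ i q → (q * s + i) % t ≡ r → q % t ≡ j₀ i
  on-runner⇒ i q on = trans (≋-cancel-*ʳ t⊥s (≋-cancel-+ʳ i (trans on (trans (sym r%t≡r) (sym (j₀-spec i))))))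
                            (m<n⇒m%n≡m (j₀<t i))

  on-runner⇐ : ∀ i q → q % t ≡ j₀ i → (q * s + i) % t ≡ r
  on-runner⇐ i q q≡j₀ = trans (≋-+ (≋-*ʳ s (trans q≡j₀ (sym (m<n⇒m%n≡m (j₀<t i))))) (refl {x = i % t}))
                              (trans (j₀-spec i) r%t≡r)

  crossings : ℕ → ℕ → ℕ
  crossings i Q = Σ< Q (λ q → χ ((q * s + i) % t) r)

  offset : ℕ → ℕ
  offset i = t ∸ suc (j₀ i)

  crossings-count : ∀ i Q → t * crossings i Q + (Q + offset i) % t ≡ Q + offset i
  crossings-count i Q = trans (cong (λ n → t * n + (Q + offset i) % t)
                                    (Σ-ext Q (λ q _ → χ-cong (on-runner⇒ i q) (on-runner⇐ i q))))
                              (residue-count (j₀ i) (j₀<t i) Q)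

  offset-residue : ∀ i Q i′ Q′ → Q * s + i ≋ Q′ * s + i′ → Q + offset i ≋ Q′ + offset i′
  offset-residue i Q i′ Q′ same = ≋-cancel-*ʳ t⊥s (≋-cancel-+ʳ (r + s)
    (trans (shifted i Q) (trans same (sym (shifted i′ Q′)))))
    where
    open ≡-Reasoning
    identity : ∀ Q d j i s → (Q + d) * s + ((j * s + i) + s) ≡ (Q * s + i) + s * (d + suc j)
    identity = ℕSolver.solve-∀
    shifted : ∀ i Q → (Q + offset i) * s + (r + s) ≋ Q * s + i
    shifted i Q = begin
      ((Q + offset i) * s + (r + s)) % t                  ≡⟨ ≋-+ (refl {x = ((Q + offset i) * s) % t})
                                                                 (≋-+ (trans r%t≡r (sym (trans (j₀-spec i) r%t≡r))) (refl {x = s % t})) ⟩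
      ((Q + offset i) * s + ((j₀ i * s + i) + s)) % t    ≡⟨ cong (_% t) (identity Q (offset i) (j₀ i) i s) ⟩
      ((Q * s + i) + s * (offset i + suc (j₀ i))) % t    ≡⟨ cong (λ x → ((Q * s + i) + s * x) % t) (m∸n+n≡m (j₀<t i)) ⟩
      ((Q * s + i) + s * t) % t                          ≡⟨ ≋-multiple (Q * s + i) s ⟩
      (Q * s + i) % t                                    ∎

Σ-permute : ∀ n (π ρ : ℕ → ℕ) → (∀ i → i < n → π i < n) → (∀ j → j < n → ρ j < n) →
            (∀ j → j < n → π (ρ j) ≡ j) → (∀ i → i < n → ρ (π i) ≡ i) → (h : ℕ → ℕ) →
            Σ< n (h ∘ π) ≡ Σ< n h
Σ-permute n π ρ π< ρ< πρ ρπ h = begin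
  Σ< n (h ∘ π)                                 ≡⟨ Σ-ext n (λ i i<n → sym (Σ-point n (π i) h (π< i i<n))) ⟩
  Σ< n (λ i → Σ< n (λ j → χ j (π i) * h j))     ≡⟨ Σ-swap n n _ ⟩
  Σ< n (λ j → Σ< n (λ i → χ j (π i) * h j))     ≡⟨ Σ-ext n (λ j j<n → trans
      (Σ-ext n (λ i i<n → cong (_* h j) (χ-cong (λ j≡πi → trans (sym (ρπ i i<n)) (cong ρ (sym j≡πi)))
                                                   (λ i≡ρj → trans (sym (πρ j j<n)) (cong π (sym i≡ρj))))))
      (Σ-point n (ρ j) (λ _ → h j) (ρ< j j<n))) ⟩
  Σ< n h                                       ∎
  where open ≡-Reasoning

module IntegerDifference where
  open import Data.Integer using (+_)

  diff⇒ : ∀ z m a b → + z ℤ.- + m ≡ + a ℤ.- + b → z + b ≡ a + m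
  diff⇒ z m a b eq = ℤP.+-injective (begin
    + (z + b)                           ≡⟨ ℤP.pos-+ z b ⟩
    + z ℤ.+ + b                         ≡⟨ regroup₁ (+ z) (+ m) (+ b) ⟩
    (+ z ℤ.- + m) ℤ.+ (+ m ℤ.+ + b)     ≡⟨ cong (ℤ._+ (+ m ℤ.+ + b)) eq ⟩
    (+ a ℤ.- + b) ℤ.+ (+ m ℤ.+ + b)     ≡⟨ regroup₂ (+ a) (+ b) (+ m) ⟩
    + a ℤ.+ + m                         ≡⟨ sym (ℤP.pos-+ a m) ⟩
    + (a + m)                           ∎)
    where
    open ≡-Reasoning
    regroup₁ : ∀ x y w → x ℤ.+ w ≡ (x ℤ.- y) ℤ.+ (y ℤ.+ w)
    regroup₁ = ℤSolver.solve-∀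
    regroup₂ : ∀ x y w → (x ℤ.- y) ℤ.+ (w ℤ.+ y) ≡ x ℤ.+ w
    regroup₂ = ℤSolver.solve-∀

  diff⇐ : ∀ z m a b → z + b ≡ a + m → + z ℤ.- + m ≡ + a ℤ.- + b
  diff⇐ z m a b eq = begin
    + z ℤ.- + m                         ≡⟨ regroup (+ z) (+ m) (+ b) ⟩
    (+ z ℤ.+ + b) ℤ.- (+ b ℤ.+ + m)     ≡⟨ cong (λ x → x ℤ.- (+ b ℤ.+ + m)) (sym (ℤP.pos-+ z b)) ⟩
    + (z + b) ℤ.- (+ b ℤ.+ + m)         ≡⟨ cong (λ x → + x ℤ.- (+ b ℤ.+ + m)) eq ⟩
    + (a + m) ℤ.- (+ b ℤ.+ + m)         ≡⟨ cong (λ x → x ℤ.- (+ b ℤ.+ + m)) (ℤP.pos-+ a m) ⟩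
    (+ a ℤ.+ + m) ℤ.- (+ b ℤ.+ + m)     ≡⟨ cancel (+ a) (+ b) (+ m) ⟩
    + a ℤ.- + b                         ∎
    where
    open ≡-Reasoning
    regroup : ∀ x y w → x ℤ.- y ≡ (x ℤ.+ w) ℤ.- (w ℤ.+ y)
    regroup = ℤSolver.solve-∀
    cancel : ∀ x y w → (x ℤ.+ w) ℤ.- (y ℤ.+ w) ≡ x ℤ.- y
    cancel = ℤSolver.solve-∀

  ∣+z-+z′∣ : ∀ z z′ → z ≤ z′ → ℤ.∣ + z ℤ.- + z′ ∣ ≡ z′ ∸ z
  ∣+z-+z′∣ z z′ z≤z′ = trans (cong ℤ.∣_∣ (ℤP.[+m]-[+n]≡m⊖n z z′)) (ℤP.∣⊖∣-≤ z≤z′)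

  modℤ⇔% : ∀ s {{_ : NonZero s}} z z′ →
           ((+ s) ℤ∣ᵘ.∣ (+ z ℤ.- + z′) → z % s ≡ z′ % s) × (z % s ≡ z′ % s → (+ s) ℤ∣ᵘ.∣ (+ z ℤ.- + z′))
  modℤ⇔% s z z′ with ≤-total z z′
  ... | inj₁ z≤z′ = (λ s∣ → ∣⇒≋ z≤z′ (subst (s ℕ∣.∣_) (∣+z-+z′∣ z z′ z≤z′) s∣))
                  , (λ z≋z′ → subst (s ℕ∣.∣_) (sym (∣+z-+z′∣ z z′ z≤z′)) (≋⇒∣ z≋z′))
    where open Modular s
  ... | inj₂ z′≤z = (λ s∣ → sym (∣⇒≋ z′≤z (subst (s ℕ∣.∣_) (trans (ℤP.∣i-j∣≡∣j-i∣ (+ z) (+ z′)) (∣+z-+z′∣ z′ z z′≤z)) s∣)))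
                  , (λ z≋z′ → subst (s ℕ∣.∣_) (sym (trans (ℤP.∣i-j∣≡∣j-i∣ (+ z) (+ z′)) (∣+z-+z′∣ z′ z z′≤z))) (≋⇒∣ (sym z≋z′)))
    where open Modular s

-- On the abacus with M beads, position z stands for the integer z − M; the
-- occupied positions are exactly the shifted beta-set elements ≥ −M, and
-- every integer below −M lies in the beta-set.
module BetaSet (M : ℕ) (κ : Partition) (lκ : len κ ≤ M) where
  open import Data.Integer using (+_; -[1+_])
  open IntegerDifference

  ι : ℕ → ℤ
  ι z = + z ℤ.- + M

  Occupied : ℕ → Set
  Occupied z = ∃ λ k → k < M × bead κ M k ≡ z

  occupied⇒beta : ∀ z → Occupied z → InBeta κ (ι z)
  occupied⇒beta z (k , k<M , fk≡z) = k , diff⇐ z M (part κ k) (suc k) (begin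
    z + suc k                       ≡⟨ cong (λ x → x + suc k) (sym fk≡z) ⟩
    part κ k + (M ∸ suc k) + suc k  ≡⟨ +-assoc (part κ k) (M ∸ suc k) (suc k) ⟩
    part κ k + (M ∸ suc k + suc k)  ≡⟨ cong (λ x → part κ k + x) (m∸n+n≡m k<M) ⟩
    part κ k + M                    ∎)
    where open ≡-Reasoning

  beta⇒occupied : ∀ z → InBeta κ (ι z) → Occupied z
  beta⇒occupied z (k , ιz≡) with k <? M | diff⇒ z M (part κ k) (suc k) ιz≡
  ... | yes k<M | z+k+1≡ = k , k<M , +-cancelʳ-≡ (suc k) (bead κ M k) z (begin
    part κ k + (M ∸ suc k) + suc k  ≡⟨ +-assoc (part κ k) (M ∸ suc k) (suc k) ⟩
    part κ k + (M ∸ suc k + suc k)  ≡⟨ cong (λ x → part κ k + x) (m∸n+n≡m k<M) ⟩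
    part κ k + M                    ≡⟨ sym z+k+1≡ ⟩
    z + suc k                       ∎)
    where open ≡-Reasoning
  ... | no k≮M | z+k+1≡ rewrite part-beyond κ k (≤-trans lκ (≮⇒≥ k≮M)) =
    ⊥-elim (k≮M (≤-trans (m≤n+m (suc k) z) (≤-reflexive z+k+1≡)))

  ι-or-beta : ∀ b → (∃ λ z → b ≡ ι z) ⊎ InBeta κ b
  ι-or-beta (+ m) = inj₁ (m + M , sym (trans (diff⇐ (m + M) M m 0 (+-identityʳ (m + M))) (ℤP.+-identityʳ (+ m))))
  ι-or-beta -[1+ n ] with n <? M
  ... | yes n<M = inj₁ (M ∸ suc n , sym (diff⇐ (M ∸ suc n) M 0 (suc n) (m∸n+n≡m n<M)))
  ... | no n≮M = inj₂ (n , sym (cong (λ p → + p ℤ.- + suc n) (part-beyond κ n (≤-trans lκ (≮⇒≥ n≮M)))))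

  ι-injective : ∀ {z z′} → ι z ≡ ι z′ → z ≡ z′
  ι-injective {z} {z′} e = +-cancelʳ-≡ M z z′ (diff⇒ z M z′ M e)

  private
    ι+M : ∀ z → ι z ℤ.+ + M ≡ + z
    ι+M z = cancel (+ z) (+ M)
      where
      cancel : ∀ x m → x ℤ.- m ℤ.+ m ≡ x
      cancel = ℤSolver.solve-∀

  ι-reflects-< : ∀ {z z′} → ι z ℤ.< ι z′ → z < z′
  ι-reflects-< {z} {z′} lt = ℤP.drop‿+<+ (subst₂ ℤ._<_ (ι+M z) (ι+M z′) (ℤP.+-monoˡ-< (+ M) lt))

  ι-preserves-< : ∀ {z z′} → z < z′ → ι z ℤ.< ι z′
  ι-preserves-< lt = ℤP.+-monoˡ-< (ℤ.- + M) (ℤ.+<+ lt)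

  private
    ι-difference : ∀ z z′ → ι z ℤ.- ι z′ ≡ + z ℤ.- + z′
    ι-difference z z′ = shift-cancels (+ z) (+ z′) (+ M)
      where
      shift-cancels : ∀ a b m → (a ℤ.- m) ℤ.- (b ℤ.- m) ≡ a ℤ.- b
      shift-cancels = ℤSolver.solve-∀

  ι-mod⇒ : ∀ s {{_ : NonZero s}} z z′ → ι z ≡ ι z′ [modℤ s ] → z % s ≡ z′ % s
  ι-mod⇒ s z z′ s∣ = proj₁ (modℤ⇔% s z z′) (subst (λ x → (+ s) ℤ∣ᵘ.∣ x) (ι-difference z z′) s∣)

  ι-mod⇐ : ∀ s {{_ : NonZero s}} z z′ → z % s ≡ z′ % s → ι z ≡ ι z′ [modℤ s ]
  ι-mod⇐ s z z′ z≋z′ = subst (λ x → (+ s) ℤ∣ᵘ.∣ x) (sym (ι-difference z z′)) (proj₂ (modℤ⇔% s z z′) z≋z′)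

-- The abacus of an s-core: on each s-runner i the beads fill the levels
-- q < h i (positions q·s + i), so the first gap of runner i is at
-- h i · s + i, and these gaps are exactly the elements of 𝒬(κ) (shifted by M).
module SCoreAbacus {s : ℕ} {{_ : NonZero s}} (M : ℕ) (κ : Partition) (lκ : len κ ≤ M) (W : ℕ)
                   (beads<W : ∀ k → k < M → bead κ M k < W) (core : AbacusCore s (bead κ M) M) where
  open BetaSet M κ lκ public
  open Modular s

  private
    f : ℕ → ℕ
    f = bead κ M

  level : ℕ → ℕ → ℕ
  level i q = occupancy f M (q * s + i)

  level-initial : ∀ i → Initial (level i)
  level-initial i = CoreRunners.core-runner-initial M κ i core

  height : ℕ → ℕ
  height i = Σ< W (level i)

  private
    W≤level : ∀ i q → W ≤ q → W ≤ q * s + i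
    W≤level i q W≤q = ≤-trans W≤q (≤-trans (m≤m*n q s) (m≤m+n (q * s) i))

    empty-above : ∀ z → W ≤ z → occupancy f M z ≡ 0
    empty-above z W≤z = Σ-zero M _ (λ k k<M → χ-no (λ fk≡z → <⇒≱ (beads<W k k<M) (subst (W ≤_) (sym fk≡z) W≤z)))

  level-char : ∀ i q → (level i q ≡ 1 → q < height i) × (q < height i → level i q ≡ 1)
  level-char i q with q <? W
  ... | yes q<W = initial-char (level-initial i) W q q<W
  ... | no q≮W = (λ lvl≡1 → ⊥-elim (0≢1+n (trans (sym (empty-above _ (W≤level i q (≮⇒≥ q≮W)))) lvl≡1)))
               , (λ q<h → ⊥-elim (q≮W (<-≤-trans q<h (initial-Σ≤ (level-initial i) W))))

  gap : ℕ → ℕ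
  gap i = height i * s + i

  gap-runner : ∀ i → i < s → gap i % s ≡ i
  gap-runner i i<s = trans (cong (_% s) (+-comm (height i * s) i)) (trans (≋-multiple i (height i)) (m<n⇒m%n≡m i<s))

  private
    occupied⇒level : ∀ z → Occupied z → occupancy f M z ≡ 1
    occupied⇒level z (k , k<M , fk≡z) = ≤-antisym (occupancy≤1 f M (bead-decreasing κ M) z) (occupied⇒ f M z k k<M fk≡z)

  gap-empty : ∀ i → ¬ Occupied (gap i)
  gap-empty i occ = <-irrefl refl (proj₁ (level-char i (height i)) (occupied⇒level _ occ))

  below-gap : ∀ i → i < s → ∀ z → z < gap i → z % s ≡ i → Occupied z
  below-gap i i<s z z<gap z≡i = ⇒occupied f M z (≤-reflexive (sym (subst (λ x → occupancy f M x ≡ 1) z≡q*s+i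
    (proj₂ (level-char i (z / s)) q<h))))
    where
    z≡q*s+i : z / s * s + i ≡ z
    z≡q*s+i = trans (+-comm _ i) (trans (cong (_+ z / s * s) (sym z≡i)) (sym (m≡m%n+[m/n]*n z s)))
    q<h : z / s < height i
    q<h = *-cancelʳ-< s (z / s) (height i) (+-cancelʳ-< i _ _ (subst (_< gap i) (sym z≡q*s+i) z<gap))

  gap-in-Q : ∀ i → i < s → InQ s κ (ι (gap i))
  gap-in-Q i i<s = (λ inβ → gap-empty i (beta⇒occupied _ inβ)) , below
    where
    below : ∀ c → c ℤ.< ι (gap i) → c ≡ ι (gap i) [modℤ s ] → InBeta κ c
    below c c<gap c≡gap with ι-or-beta c
    ... | inj₂ inβ = inβ
    ... | inj₁ (z , refl) = occupied⇒beta z (below-gap i i<s z (ι-reflects-< c<gap)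
                              (trans (ι-mod⇒ s z (gap i) c≡gap) (gap-runner i i<s)))

  Q-is-gap : ∀ a → InQ s κ a → ∃ λ i → i < s × a ≡ ι (gap i)
  Q-is-gap a (a∉β , below) with ι-or-beta a
  ... | inj₂ a∈β = ⊥-elim (a∉β a∈β)
  ... | inj₁ (z , refl) = z % s , m%n<n z s , cong ι z≡gap
    where
    i<s : z % s < s
    i<s = m%n<n z s
    z≡gap : z ≡ gap (z % s)
    z≡gap with <-cmp z (gap (z % s))
    ... | tri≈ _ z≡ _ = z≡
    ... | tri< z<gap _ _ = ⊥-elim (a∉β (occupied⇒beta z (below-gap (z % s) i<s z z<gap refl)))
    ... | tri> _ _ gap<z = ⊥-elim (gap-empty (z % s) (beta⇒occupied _
            (below (ι (gap (z % s))) (ι-preserves-< gap<z) (ι-mod⇐ s (gap (z % s)) z (gap-runner (z % s) i<s)))))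

  bead-sum : ∀ (h : ℕ → ℕ) → Σ< M (h ∘ f) ≡ Σ< s (λ i → Σ< (height i) (λ q → h (q * s + i)))
  bead-sum h = begin
    Σ< M (h ∘ f)                                                ≡⟨ sym (occupancy-sum f M (W * s) h
                                                                      (λ k k<M → <-≤-trans (beads<W k k<M) (m≤m*n W s))) ⟩
    Σ< (W * s) (λ z → h z * occupancy f M z)                    ≡⟨ Σ-blocks W s _ ⟩
    Σ< W (λ q → Σ< s (λ i → h (q * s + i) * level i q))         ≡⟨ Σ-swap W s _ ⟩
    Σ< s (λ i → Σ< W (λ q → h (q * s + i) * level i q))         ≡⟨ Σ-ext s (λ i _ → initial-weighted-sum (level-initial i) W _) ⟩
    Σ< s (λ i → Σ< (height i) (λ q → h (q * s + i)))            ∎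
    where open ≡-Reasoning

  -- Every bead lies on exactly one s-runner.
  total-height : Σ< s height ≡ M
  total-height = begin
    Σ< s height                               ≡⟨ Σ-ext s (λ i _ → sym (Σ-ones (height i))) ⟩
    Σ< s (λ i → Σ< (height i) (λ _ → 1))      ≡⟨ sym (bead-sum (λ _ → 1)) ⟩
    Σ< M (λ _ → 1)                            ≡⟨ Σ-ones M ⟩
    M                                         ∎
    where open ≡-Reasoning

-- On runner r, s-runner i of height h
-- contributes ⌊(h + offset i)/t⌋ beads; summing the division-free form of
-- this over i, the total height M and the offsets are the same for λ and μ,
-- and the remainders agree because φ permutes the gaps preserving them mod t.
module SameRunnerCounts {s t : ℕ} {{_ : NonZero s}} {{_ : NonZero t}} (s⊥t : Coprime s t)
  (λp μ : Partition) (M W : ℕ) (lλ : len λp ≤ M) (lμ : len μ ≤ M)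
  (λ<W : ∀ k → k < M → bead λp M k < W) (μ<W : ∀ k → k < M → bead μ M k < W)
  (coreλ : AbacusCore s (bead λp M) M) (coreμ : AbacusCore s (bead μ M) M)
  (φ : ℤ → ℤ)
  (φ-into : ∀ b → InQ s λp b → InQ s μ (φ b))
  (φ-injective : ∀ b c → InQ s λp b → InQ s λp c → φ b ≡ φ c → b ≡ c)
  (φ-onto : ∀ d → InQ s μ d → Σ ℤ (λ b → InQ s λp b × φ b ≡ d))
  (φ-mod : ∀ b → InQ s λp b → φ b ≡ b [modℤ t ])
  where

  module Λ = SCoreAbacus M λp lλ W λ<W coreλ
  module Μ = SCoreAbacus M μ lμ W μ<W coreμ

  -- φ induces a permutation π of the s-runners, with inverse ρ.
  π : ℕ → ℕ
  π i with i <? s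
  ... | yes i<s = proj₁ (Μ.Q-is-gap _ (φ-into _ (Λ.gap-in-Q i i<s)))
  ... | no _    = 0

  π-gap : ∀ i → i < s → π i < s × φ (Λ.ι (Λ.gap i)) ≡ Μ.ι (Μ.gap (π i))
  π-gap i i<s with i <? s
  ... | yes i<s′ = proj₂ (Μ.Q-is-gap _ (φ-into _ (Λ.gap-in-Q i i<s′)))
  ... | no i≮s   = ⊥-elim (i≮s i<s)

  ρ : ℕ → ℕ
  ρ j with j <? s
  ... | yes j<s = proj₁ (Λ.Q-is-gap _ (proj₁ (proj₂ (φ-onto _ (Μ.gap-in-Q j j<s)))))
  ... | no _    = 0

  ρ-gap : ∀ j → j < s → ρ j < s × φ (Λ.ι (Λ.gap (ρ j))) ≡ Μ.ι (Μ.gap j)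
  ρ-gap j j<s with j <? s
  ... | no j≮s   = ⊥-elim (j≮s j<s)
  ... | yes j<s′ with φ-onto _ (Μ.gap-in-Q j j<s′)
  ...   | b , b∈Q , φb≡ with Λ.Q-is-gap b b∈Q
  ...     | i , i<s , refl = i<s , φb≡

  private
    gap-injective : ∀ {g : ℕ → ℕ} → (∀ i → i < s → g i % s ≡ i) → ∀ {i i′} → i < s → i′ < s → g i ≡ g i′ → i ≡ i′
    gap-injective runner {i} {i′} i<s i′<s e = trans (sym (runner i i<s)) (trans (cong (_% s) e) (runner i′ i′<s))

  πρ : ∀ j → j < s → π (ρ j) ≡ j
  πρ j j<s = gap-injective Μ.gap-runner (proj₁ (π-gap (ρ j) ρj<s)) j<s
               (Μ.ι-injective (trans (sym (proj₂ (π-gap (ρ j) ρj<s))) (proj₂ (ρ-gap j j<s))))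
    where
    ρj<s : ρ j < s
    ρj<s = proj₁ (ρ-gap j j<s)

  ρπ : ∀ i → i < s → ρ (π i) ≡ i
  ρπ i i<s = gap-injective Λ.gap-runner ρπi<s i<s (Λ.ι-injective
               (φ-injective _ _ (Λ.gap-in-Q (ρ (π i)) ρπi<s) (Λ.gap-in-Q i i<s)
                 (trans (proj₂ (ρ-gap (π i) πi<s)) (sym (proj₂ (π-gap i i<s))))))
    where
    πi<s : π i < s
    πi<s = proj₁ (π-gap i i<s)
    ρπi<s : ρ (π i) < s
    ρπi<s = proj₁ (ρ-gap (π i) πi<s)

  π-residue : ∀ i → i < s → Μ.gap (π i) % t ≡ Λ.gap i % t
  π-residue i i<s = Λ.ι-mod⇒ t (Μ.gap (π i)) (Λ.gap i)
    (subst (λ x → x ≡ Λ.ι (Λ.gap i) [modℤ t ]) (proj₂ (π-gap i i<s)) (φ-mod _ (Λ.gap-in-Q i i<s)))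

  module _ (r : ℕ) (r<t : r < t) where
    open RunnerCrossing s⊥t r r<t

    private
      count-identity : ∀ (κ : Partition) (lκ : len κ ≤ M) (κ<W : ∀ k → k < M → bead κ M k < W)
                       (core : AbacusCore s (bead κ M) M) → let open SCoreAbacus M κ lκ W κ<W core in
                       t * runnerCount t r (bead κ M) M + Σ< s (λ i → (height i + offset i) % t) ≡ M + Σ< s offset
      count-identity κ lκ κ<W core = begin
        t * runnerCount t r (bead κ M) M + Σ< s (λ i → (height i + offset i) % t)
          ≡⟨ cong (λ n → t * n + Σ< s (λ i → (height i + offset i) % t)) (bead-sum (λ z → χ (z % t) r)) ⟩
        t * Σ< s (λ i → crossings i (height i)) + Σ< s (λ i → (height i + offset i) % t)
          ≡⟨ cong (_+ Σ< s (λ i → (height i + offset i) % t)) (sym (Σ-* s t (λ i → crossings i (height i)))) ⟩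
        Σ< s (λ i → t * crossings i (height i)) + Σ< s (λ i → (height i + offset i) % t)
          ≡⟨ sym (Σ-+ s _ _) ⟩
        Σ< s (λ i → t * crossings i (height i) + (height i + offset i) % t)
          ≡⟨ Σ-ext s (λ i _ → crossings-count i (height i)) ⟩
        Σ< s (λ i → height i + offset i)
          ≡⟨ Σ-+ s height offset ⟩
        Σ< s height + Σ< s offset
          ≡⟨ cong (_+ Σ< s offset) total-height ⟩
        M + Σ< s offset ∎
        where
        open ≡-Reasoning
        open SCoreAbacus M κ lκ W κ<W core

      -- The remainders of λ and μ agree: reindex by π, then use that π
      -- preserves the gaps mod t.
      remainders : Σ< s (λ i → (Μ.height i + offset i) % t) ≡ Σ< s (λ i → (Λ.height i + offset i) % t)
      remainders = begin
        Σ< s (λ i → (Μ.height i + offset i) % t)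
          ≡⟨ sym (Σ-permute s π ρ (λ i i<s → proj₁ (π-gap i i<s)) (λ j j<s → proj₁ (ρ-gap j j<s)) πρ ρπ _) ⟩
        Σ< s (λ i → (Μ.height (π i) + offset (π i)) % t)
          ≡⟨ Σ-ext s (λ i i<s → offset-residue (π i) (Μ.height (π i)) i (Λ.height i) (π-residue i i<s)) ⟩
        Σ< s (λ i → (Λ.height i + offset i) % t) ∎
        where open ≡-Reasoning

    runnerCounts-agree : runnerCount t r (bead λp M) M ≡ runnerCount t r (bead μ M) M
    runnerCounts-agree = *-cancelˡ-≡ _ _ t (+-cancelʳ-≡ (Σ< s (λ i → (Λ.height i + offset i) % t)) _ _ (begin
      t * runnerCount t r (bead λp M) M + Σ< s (λ i → (Λ.height i + offset i) % t)  ≡⟨ count-identity λp lλ λ<W coreλ ⟩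
      M + Σ< s offset                                                             ≡⟨ sym (count-identity μ lμ μ<W coreμ) ⟩
      t * runnerCount t r (bead μ M) M + Σ< s (λ i → (Μ.height i + offset i) % t)   ≡⟨ cong (t * runnerCount t r (bead μ M) M +_) remainders ⟩
      t * runnerCount t r (bead μ M) M + Σ< s (λ i → (Λ.height i + offset i) % t)   ∎))
      where open ≡-Reasoning

proposition4p1 : (s t : ℕ) → 0 < s → 0 < t → Coprime s t →
  (λp μ : Partition) → IsCore s λp → IsCore s μ →
  (φ : ℤ → ℤ) →
  (∀ b → InQ s λp b → InQ s μ (φ b)) →
  (∀ b c → InQ s λp b → InQ s λp c → φ b ≡ φ c → b ≡ c) →
  (∀ d → InQ s μ d → Σ ℤ (λ b → InQ s λp b × φ b ≡ d)) →
  (∀ b → InQ s λp b → φ b ≡ b [modℤ t ]) →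
  ∃[ ν ] (IsCoreOf t λp ν × IsCoreOf t μ ν)
proposition4p1 s t s>0 t>0 s⊥t λp μ coreλ coreμ φ φ-into φ-injective φ-onto φ-mod =
  same-t-core λp μ M lλ lμ
    (SameRunnerCounts.runnerCounts-agree s⊥t λp μ M W lλ lμ λ<W μ<W
       (Cores.core⇒abacus s>0 M λp lλ coreλ) (Cores.core⇒abacus s>0 M μ lμ coreμ)
       φ φ-into φ-injective φ-onto φ-mod)
  where
  instance
    s≢0 : NonZero s
    s≢0 = ℕ.>-nonZero s>0
    t≢0 : NonZero t
    t≢0 = ℕ.>-nonZero t>0

  M W : ℕ
  M = len λp + len μ
  W = suc (part λp 0 + part μ 0 + M)

  lλ : len λp ≤ M
  lλ = m≤m+n (len λp) (len μ)
  lμ : len μ ≤ M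
  lμ = m≤n+m (len μ) (len λp)

  λ<W : ∀ k → k < M → bead λp M k < W
  λ<W k _ = s≤s (≤-trans (bead-bound λp M k) (+-monoˡ-≤ M (m≤m+n (part λp 0) (part μ 0))))
  μ<W : ∀ k → k < M → bead μ M k < W
  μ<W k _ = s≤s (≤-trans (bead-bound μ M k) (+-monoˡ-≤ M (m≤n+m (part μ 0) (part λp 0))))
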